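{- Let $s\ge 2$, $n\ge 1$, let $F_{s-1}$ be the free group on $x_1,\dots,x_{s-1}$, let $R_n$ be the kernel of $F_{s-1}\to\mathbb{Z}/n\mathbb{Z}$ sending each $x_j$ to $1$, so that $H_1(Y_n,\mathbb{Z})=R_n/R_n'$ for the corresponding cyclic cover $Y_n$ of $X_s=\mathbb{P}^1\setminus\{s\text{ points}\}$. Let $\mathrm{Gal}(Y_n/X_s)=\mathbb{Z}/n\mathbb{Z}=\langle\sigma\rangle$ act on $R_n/R_n'$ by conjugation by $x_1$. Then the subgroup of $\sigma$-invariant elements of $H_1(Y_n,\mathbb{Z})$ (resp. of $H_1(Y_n,\mathbb{Z}_\ell)=H_1(Y_n,\mathbb{Z})\otimes_{\mathbb{Z}}\mathbb{Z}_\ell$) is the subgroup (resp. $\mathbb{Z}_\ell$-submodule) generated by the classes of \[ \{x_i^{n}:1\le i\le s-1\}. \]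
   Context: $\ell$ is a prime; $R_n'$ denotes the commutator subgroup of $R_n$. -}

module Defs where

open import Data.Nat as ℕ using (ℕ; zero; suc; _≤_; _^_; s≤s)
open import Data.Bool using (Bool; true; false; not)
open import Data.Fin using (Fin; zero; suc)
open import Data.Integer as ℤ using (ℤ; +_; -[1+_])
open import Data.Integer.Divisibility using () renaming (_∣_ to _∣ℤ_)
open import Data.List using (List; []; _∷_; _++_; map; reverse; replicate; concat; allFin; upTo)
open import Data.Product using (_×_; _,_)

-- The free group F_m on x_1,…,x_m (here m = s - 1), as words modulo
-- free reduction.  A letter (i , true) is x_{i+1}, (i , false) its inverse.

Letter : ℕ → Set
Letter m = Fin m × Bool

Word : ℕ → Set
Word m = List (Letter m)

flipL : ∀ {m} → Letter m → Letter m
flipL (i , b) = i , not b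

inv : ∀ {m} → Word m → Word m
inv w = reverse (map flipL w)

data _≈F_ {m : ℕ} : Word m → Word m → Set where
  F-refl   : ∀ {w} → w ≈F w
  F-sym    : ∀ {w v} → w ≈F v → v ≈F w
  F-trans  : ∀ {u v w} → u ≈F v → v ≈F w → u ≈F w
  F-cancel : ∀ (u v : Word m) (x : Letter m) → (u ++ x ∷ flipL x ∷ v) ≈F (u ++ v)

-- exponent sum; this is the homomorphism F_m → ℤ whose reduction mod n
-- is F_m → ℤ/nℤ, x_j ↦ 1
expSum : ∀ {m} → Word m → ℤ
expSum []               = + 0
expSum ((_ , true) ∷ w)  = + 1 ℤ.+ expSum w
expSum ((_ , false) ∷ w) = -[1+ 0 ] ℤ.+ expSum w

InR : ∀ {m} → ℕ → Word m → Set
InR n w = (+ n) ∣ℤ expSum w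

comm : ∀ {m} → Word m → Word m → Word m
comm a b = a ++ b ++ inv a ++ inv b

-- membership in R_n' = [R_n , R_n]: the subgroup generated by commutators of
-- elements of R_n, i.e. (finite) products of such commutators, up to ≈F
data InRComm {m : ℕ} (n : ℕ) : Word m → Set where
  rc-nil  : InRComm n []
  rc-step : ∀ (a b w : Word m) → InR n a → InR n b → InRComm n w → InRComm n (comm a b ++ w)
  rc-resp : ∀ {w v : Word m} → w ≈F v → InRComm n w → InRComm n v

-- equality in H_1(Y_n,ℤ) = R_n / R_n' of (classes of) elements of R_n
_≡H[_]_ : ∀ {m} → Word m → ℕ → Word m → Set
r ≡H[ n ] r' = InRComm n (r ++ inv r')

x₁ : ∀ {s} → 2 ≤ s → Fin (s ℕ.∸ 1)
x₁ {suc (suc k)} _ = zero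
x₁ {suc zero} (s≤s ())

conj₁ : ∀ {s} → 2 ≤ s → Word (s ℕ.∸ 1) → Word (s ℕ.∸ 1)
conj₁ h r = (x₁ h , true) ∷ r ++ ((x₁ h , false) ∷ [])

powL : ∀ {m} → Fin m → ℤ → Word m
powL i (+ k)     = replicate k (i , true)
powL i -[1+ k ]  = replicate (suc k) (i , false)

genProd : ∀ {m} → ℕ → (Fin m → ℤ) → Word m
genProd {m} n c = concat (map (λ i → powL i ((+ n) ℤ.* c i)) (allFin m))

-- ℓ-adic integers ℤ_ℓ: an element is represented by a sequence of
-- (unconstrained) digits a_i ∈ ℕ standing for Σ_i a_i ℓ^i; two sequences
-- are equal iff their partial sums agree modulo ℓ^k for every k.

Zℓ : Set
Zℓ = ℕ → ℕ

partial : ℕ → Zℓ → ℕ → ℕ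
partial ℓ a zero    = 0
partial ℓ a (suc k) = partial ℓ a k ℕ.+ a k ℕ.* ℓ ^ k

_≈[_]_ : Zℓ → ℕ → Zℓ → Set
a ≈[ ℓ ] b = ∀ k → (+ (ℓ ^ k)) ∣ℤ ((+ partial ℓ a k) ℤ.- (+ partial ℓ b k))

0ℓ : Zℓ
0ℓ _ = 0

_+ℓ_ : Zℓ → Zℓ → Zℓ
(a +ℓ b) i = a i ℕ.+ b i

-- H_1(Y_n,ℤ_ℓ) = (R_n/R_n') ⊗_ℤ ℤ_ℓ, presented as finite formal sums
-- Σ r_j ⊗ a_j (lists) modulo the tensor-product relations.  All relations
-- only touch words lying in R_n.

TSum : ℕ → Set
TSum m = List (Word m × Zℓ)

data TStep {m : ℕ} (n ℓ : ℕ) : TSum m → TSum m → Set where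
  t-swap : ∀ p q → TStep n ℓ (p ∷ q ∷ []) (q ∷ p ∷ [])
  t-addZ : ∀ r a b → InR n r → TStep n ℓ ((r , a) ∷ (r , b) ∷ []) ((r , a +ℓ b) ∷ [])
  t-addH : ∀ r r' a → InR n r → InR n r' → TStep n ℓ ((r , a) ∷ (r' , a) ∷ []) ((r ++ r' , a) ∷ [])
  t-H    : ∀ r r' a → InR n r → InR n r' → r ≡H[ n ] r' → TStep n ℓ ((r , a) ∷ []) ((r' , a) ∷ [])
  t-Zℓ   : ∀ r a b → InR n r → a ≈[ ℓ ] b → TStep n ℓ ((r , a) ∷ []) ((r , b) ∷ [])
  t-zero : ∀ r → InR n r → TStep n ℓ [] ((r , 0ℓ) ∷ [])

data _≈T[_,_]_ {m : ℕ} : TSum m → ℕ → ℕ → TSum m → Set where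
  T-refl  : ∀ {n ℓ t} → t ≈T[ n , ℓ ] t
  T-sym   : ∀ {n ℓ t u} → t ≈T[ n , ℓ ] u → u ≈T[ n , ℓ ] t
  T-trans : ∀ {n ℓ t u v} → t ≈T[ n , ℓ ] u → u ≈T[ n , ℓ ] v → t ≈T[ n , ℓ ] v
  T-step  : ∀ {n ℓ} (u v : TSum m) {t t'} → TStep n ℓ t t' → (u ++ t ++ v) ≈T[ n , ℓ ] (u ++ t' ++ v)

σT : ∀ {s} → 2 ≤ s → TSum (s ℕ.∸ 1) → TSum (s ℕ.∸ 1)
σT h t = map (λ { (r , a) → conj₁ h r , a }) t

-- Σ_i c_i · (x_i^n ⊗ 1) = Σ_i x_i^n ⊗ c_i
genSumℓ : ∀ {m} → ℕ → (Fin m → Zℓ) → TSum m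
genSumℓ {m} n c = map (λ i → replicate n (i , true) , c i) (allFin m)

module Submission where

-- R_n is the fundamental group of the n-fold cyclic cover of the bouquet of circles x_1, …, x_(s-1):
-- a word in R_n lifts to a closed path, and counting how often the lift crosses each edge gives a
-- homomorphism chain from R_n/R_n' to the 1-chains of the cover. It is injective, because
-- Reidemeister–Schreier rewriting writes every element of R_n as a product of the generators
-- x^k x_j x^-(k+1 mod n), and in R_n/R_n' such a product is determined by its exponents, which are
-- exactly the values of the chain. Conjugation by x_1 rotates the cover, i.e. shifts chains by one
-- level, so the invariant classes are those whose chain does not depend on the level; these are the
-- chains of x_1^(n c_1) ⋯ x_(s-1)^(n c_(s-1)). Over ℤ_ℓ the same argument runs with the chains paired
-- against the ℓ-adic coefficients modulo every ℓ^k.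

open import Defs
open import Algebra.Bundles using (CommutativeMonoid)
import Algebra.Properties.CommutativeMonoid.Sum
open import Data.Bool using (true; false)
open import Data.Empty using (⊥-elim)
open import Data.Fin as Fin using (Fin; zero; suc; toℕ)
import Data.Fin.Properties as Finₚ
open import Data.Integer using (ℤ; +_; -[1+_]; _+_; _-_; -_; _*_)
import Data.Integer.Divisibility.Signed as ℤ∣
import Data.Integer.Properties as ℤₚ
open import Algebra.Properties.AbelianGroup ℤₚ.+-0-abelianGroup
  using () renaming (inverseʳ-unique to ℤ-inverseʳ-unique; x∙y⁻¹≈ε⇒x≈y to ℤ-x-y≡0⇒x≡y)
open import Data.Integer.Tactic.RingSolver using (solve-∀)
open import Data.List using ([]; _∷_; _++_; map; reverse; replicate; concat; tabulate)
open import Data.List.Properties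
  using (++-assoc; ++-identityʳ; map-++; map-tabulate; reverse-++; reverse-map; reverse-involutive; map-∘; map-id; map-cong)
open import Data.List.Relation.Unary.All using (All; []; _∷_)
open import Data.Nat as ℕ using (ℕ; zero; suc; _≤_; _<_; _∸_; _^_; s≤s; z≤n)
open import Data.Nat.Tactic.RingSolver using () renaming (solve-∀ to ℕ-solve-∀)
import Data.Nat.Properties as ℕₚ
import Data.Nat.Divisibility as ℕ∣
open import Data.Nat.Primality using (Prime; ¬prime[0])
open import Data.Product using (_×_; _,_; Σ; proj₁; proj₂; map₂)
open import Data.Sum using (inj₁; inj₂)
open import Function using (_∘_; id)
open import Relation.Binary.PropositionalEquality
  using (_≡_; _≢_; refl; sym; trans; cong; cong₂; subst; subst₂; module ≡-Reasoning) renaming (setoid to ≡-setoid)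
open import Relation.Binary.Bundles using (Setoid)
import Relation.Binary.Reasoning.Setoid
open import Relation.Nullary using (¬_; yes; no)

-- Free groups

replicate-+ : {A : Set} (a b : ℕ) (y : A) → replicate (a ℕ.+ b) y ≡ replicate a y ++ replicate b y
replicate-+ zero    b y = refl
replicate-+ (suc a) b y = cong (y ∷_) (replicate-+ a b y)

module _ {m : ℕ} where

  flipL-involutive : (x : Letter m) → flipL (flipL x) ≡ x
  flipL-involutive (i , true)  = refl
  flipL-involutive (i , false) = refl

  ≈F-reflexive : {u v : Word m} → u ≡ v → u ≈F v
  ≈F-reflexive refl = F-refl

  ≈F-congˡ : (a : Word m) {u v : Word m} → u ≈F v → (a ++ u) ≈F (a ++ v)
  ≈F-congˡ a F-refl        = F-refl
  ≈F-congˡ a (F-sym p)     = F-sym (≈F-congˡ a p)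
  ≈F-congˡ a (F-trans p q) = F-trans (≈F-congˡ a p) (≈F-congˡ a q)
  ≈F-congˡ a (F-cancel u v x) =
    subst₂ _≈F_ (++-assoc a u _) (++-assoc a u v) (F-cancel (a ++ u) v x)

  ≈F-congʳ : (b : Word m) {u v : Word m} → u ≈F v → (u ++ b) ≈F (v ++ b)
  ≈F-congʳ b F-refl        = F-refl
  ≈F-congʳ b (F-sym p)     = F-sym (≈F-congʳ b p)
  ≈F-congʳ b (F-trans p q) = F-trans (≈F-congʳ b p) (≈F-congʳ b q)
  ≈F-congʳ b (F-cancel u v x) =
    subst₂ _≈F_ (sym (++-assoc u _ b)) (sym (++-assoc u v b)) (F-cancel u (v ++ b) x)

  inv-++ : (u v : Word m) → inv (u ++ v) ≡ inv v ++ inv u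
  inv-++ u v = trans (cong reverse (map-++ flipL u v)) (reverse-++ (map flipL u) (map flipL v))

  inv-involutive : (u : Word m) → inv (inv u) ≡ u
  inv-involutive u = begin
    reverse (map flipL (reverse (map flipL u))) ≡⟨ cong reverse (reverse-map flipL (map flipL u)) ⟩
    reverse (reverse (map flipL (map flipL u))) ≡⟨ reverse-involutive _ ⟩
    map flipL (map flipL u)                     ≡⟨ map-∘ u ⟨
    map (flipL ∘ flipL) u                       ≡⟨ map-cong flipL-involutive u ⟩
    map id u                                    ≡⟨ map-id u ⟩
    u                                           ∎
    where open ≡-Reasoning

  inverseʳ : (u : Word m) → (u ++ inv u) ≈F []
  inverseʳ []      = F-refl
  inverseʳ (x ∷ u) = F-trans (≈F-reflexive (cong (x ∷_) split))
                       (F-trans (≈F-congˡ (x ∷ []) (≈F-congʳ (flipL x ∷ []) (inverseʳ u)))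
                         (F-cancel [] [] x))
    where
    split : u ++ inv (x ∷ u) ≡ (u ++ inv u) ++ flipL x ∷ []
    split = trans (cong (u ++_) (inv-++ (x ∷ []) u)) (sym (++-assoc u (inv u) _))

  inverseˡ : (u : Word m) → (inv u ++ u) ≈F []
  inverseˡ u = subst (λ v → (inv u ++ v) ≈F []) (inv-involutive u) (inverseʳ (inv u))

  inv-cong : {u v : Word m} → u ≈F v → inv u ≈F inv v
  inv-cong F-refl        = F-refl
  inv-cong (F-sym p)     = F-sym (inv-cong p)
  inv-cong (F-trans p q) = F-trans (inv-cong p) (inv-cong q)
  inv-cong (F-cancel u v x) =
    subst₂ _≈F_ (sym inv-lhs) (sym (inv-++ u v)) (F-cancel (inv v) (inv u) x)
    where
    inv-lhs : inv (u ++ x ∷ flipL x ∷ v) ≡ inv v ++ x ∷ flipL x ∷ inv u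
    inv-lhs = begin
      inv (u ++ x ∷ flipL x ∷ v)                          ≡⟨ inv-++ u _ ⟩
      inv (x ∷ flipL x ∷ v) ++ inv u                      ≡⟨ cong (_++ inv u) (inv-++ (x ∷ flipL x ∷ []) v) ⟩
      (inv v ++ flipL (flipL x) ∷ flipL x ∷ []) ++ inv u  ≡⟨ cong (λ y → (inv v ++ y ∷ flipL x ∷ []) ++ inv u) (flipL-involutive x) ⟩
      (inv v ++ x ∷ flipL x ∷ []) ++ inv u                ≡⟨ ++-assoc (inv v) _ (inv u) ⟩
      inv v ++ x ∷ flipL x ∷ inv u                        ∎
      where open ≡-Reasoning

  inv-replicate : ∀ k (x : Letter m) → inv (replicate k x) ≡ replicate k (flipL x)
  inv-replicate zero    x = refl
  inv-replicate (suc k) x = begin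
    inv (x ∷ replicate k x)                ≡⟨ inv-++ (x ∷ []) (replicate k x) ⟩
    inv (replicate k x) ++ flipL x ∷ []    ≡⟨ cong (_++ flipL x ∷ []) (inv-replicate k x) ⟩
    replicate k (flipL x) ++ flipL x ∷ []  ≡⟨ snoc k ⟩
    replicate (suc k) (flipL x)            ∎
    where
    open ≡-Reasoning
    snoc : ∀ k → replicate k (flipL x) ++ flipL x ∷ [] ≡ flipL x ∷ replicate k (flipL x)
    snoc zero    = refl
    snoc (suc k) = cong (flipL x ∷_) (snoc k)

  expSum-++ : (u v : Word m) → expSum (u ++ v) ≡ expSum u + expSum v
  expSum-++ []                v = sym (ℤₚ.+-identityˡ _)
  expSum-++ ((_ , true) ∷ u)  v = trans (cong (λ z → + 1 + z) (expSum-++ u v)) (sym (ℤₚ.+-assoc (+ 1) (expSum u) (expSum v)))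
  expSum-++ ((_ , false) ∷ u) v = trans (cong (λ z → -[1+ 0 ] + z) (expSum-++ u v)) (sym (ℤₚ.+-assoc -[1+ 0 ] (expSum u) (expSum v)))

  expSum-flipL : (x : Letter m) → expSum (flipL x ∷ []) ≡ - expSum (x ∷ [])
  expSum-flipL (_ , true)  = refl
  expSum-flipL (_ , false) = refl

  expSum-inv : (u : Word m) → expSum (inv u) ≡ - expSum u
  expSum-inv []      = refl
  expSum-inv (x ∷ u) = begin
    expSum (inv (x ∷ u))                   ≡⟨ cong expSum (inv-++ (x ∷ []) u) ⟩
    expSum (inv u ++ flipL x ∷ [])         ≡⟨ expSum-++ (inv u) _ ⟩
    expSum (inv u) + expSum (flipL x ∷ []) ≡⟨ cong₂ _+_ (expSum-inv u) (expSum-flipL x) ⟩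
    - expSum u + - expSum (x ∷ [])         ≡⟨ ℤₚ.neg-distrib-+ (expSum u) _ ⟨
    - (expSum u + expSum (x ∷ []))         ≡⟨ cong -_ (ℤₚ.+-comm (expSum u) _) ⟩
    - (expSum (x ∷ []) + expSum u)         ≡⟨ cong -_ (expSum-++ (x ∷ []) u) ⟨
    - expSum (x ∷ u)                       ∎
    where open ≡-Reasoning

  expSum-replicate : (t : Fin m) (k : ℕ) → expSum (replicate k (t , true)) ≡ + k
  expSum-replicate t zero    = refl
  expSum-replicate t (suc k) = cong (λ z → + 1 + z) (expSum-replicate t k)

  pow : Word m → ℤ → Word m
  pow h (+ k)    = concat (replicate k h)
  pow h -[1+ k ] = concat (replicate (suc k) (inv h))

  pow-suc : (h : Word m) (z : ℤ) → (h ++ pow h z) ≈F pow h (+ 1 + z)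
  pow-suc h (+ k)          = F-refl
  pow-suc h -[1+ zero ]    = F-trans (≈F-congˡ h (≈F-reflexive (++-identityʳ (inv h)))) (inverseʳ h)
  pow-suc h -[1+ suc k ]   = F-trans (≈F-reflexive (sym (++-assoc h (inv h) _))) (≈F-congʳ _ (inverseʳ h))

  pow-pred : (h : Word m) (z : ℤ) → (inv h ++ pow h z) ≈F pow h (-[1+ 0 ] + z)
  pow-pred h (+ zero)      = F-refl
  pow-pred h (+ suc k)     = F-trans (≈F-reflexive (sym (++-assoc (inv h) h _))) (≈F-congʳ _ (inverseˡ h))
  pow-pred h -[1+ k ]      = F-refl

  pow-+ : (h : Word m) (a b : ℤ) → pow h (a + b) ≈F (pow h a ++ pow h b)
  pow-+ h (+ zero)        b = ≈F-reflexive (cong (pow h) (ℤₚ.+-identityˡ b))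
  pow-+ h (+ suc k)       b =
    F-trans (≈F-reflexive (cong (pow h) (ℤₚ.+-assoc (+ 1) (+ k) b)))
      (F-trans (F-sym (pow-suc h (+ k + b)))
        (F-trans (≈F-congˡ h (pow-+ h (+ k) b)) (≈F-reflexive (sym (++-assoc h _ _)))))
  pow-+ h -[1+ zero ]     b =
    F-trans (F-sym (pow-pred h b)) (≈F-reflexive (cong (_++ pow h b) (sym (++-identityʳ (inv h)))))
  pow-+ h -[1+ suc k ]    b =
    F-trans (≈F-reflexive (cong (pow h) (ℤₚ.+-assoc -[1+ 0 ] -[1+ k ] b)))
      (F-trans (F-sym (pow-pred h (-[1+ k ] + b)))
        (F-trans (≈F-congˡ (inv h) (pow-+ h -[1+ k ] b)) (≈F-reflexive (sym (++-assoc (inv h) _ _)))))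

infix 4 _≡_mod_

-- A record, so that Agda can infer a and b from a proof.
record _≡_mod_ (a b : ℤ) (q : ℕ) : Set where
  constructor ≡mod
  field ∣-difference : (+ q) ℤ∣.∣ (a - b)
open _≡_mod_ public

module _ {q : ℕ} where

  ≡mod-reflexive : {a b : ℤ} → a ≡ b → a ≡ b mod q
  ≡mod-reflexive {a} refl = ≡mod (ℤ∣.divides (+ 0) (ℤₚ.+-inverseʳ a))

  ≡mod-refl : {a : ℤ} → a ≡ a mod q
  ≡mod-refl = ≡mod-reflexive refl

  ≡mod-sym : {a b : ℤ} → a ≡ b mod q → b ≡ a mod q
  ≡mod-sym {a} {b} (≡mod p) = ≡mod (subst ((+ q) ℤ∣.∣_) (negate-difference a b) (ℤ∣.∣m⇒∣-m p))
    where
    negate-difference : ∀ a b → - (a - b) ≡ b - a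
    negate-difference = solve-∀

  ≡mod-trans : {a b c : ℤ} → a ≡ b mod q → b ≡ c mod q → a ≡ c mod q
  ≡mod-trans {a} {b} {c} (≡mod p) (≡mod r) = ≡mod (subst ((+ q) ℤ∣.∣_) (add-differences a b c) (ℤ∣.∣m∣n⇒∣m+n p r))
    where
    add-differences : ∀ a b c → (a - b) + (b - c) ≡ a - c
    add-differences = solve-∀

  ≡mod-+-cong : {a b c d : ℤ} → a ≡ b mod q → c ≡ d mod q → a + c ≡ b + d mod q
  ≡mod-+-cong {a} {b} {c} {d} (≡mod p) (≡mod r) = ≡mod (subst ((+ q) ℤ∣.∣_) (regroup a b c d) (ℤ∣.∣m∣n⇒∣m+n p r))
    where
    regroup : ∀ a b c d → (a - b) + (c - d) ≡ (a + c) - (b + d)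
    regroup = solve-∀

  ≡mod-*-congˡ : (z : ℤ) {a b : ℤ} → a ≡ b mod q → z * a ≡ z * b mod q
  ≡mod-*-congˡ z {a} {b} (≡mod p) = ≡mod (subst ((+ q) ℤ∣.∣_) (distribute z a b) (ℤ∣.∣n⇒∣m*n z p))
    where
    distribute : ∀ z a b → z * (a - b) ≡ z * a - z * b
    distribute = solve-∀

  ∣⇒≡0-mod : {a : ℤ} → (+ q) ℤ∣.∣ a → a ≡ + 0 mod q
  ∣⇒≡0-mod {a} p = ≡mod (subst ((+ q) ℤ∣.∣_) (sym (ℤₚ.+-identityʳ a)) p)

≡mod-setoid : ℕ → Setoid _ _
≡mod-setoid q = record
  { Carrier       = ℤ
  ; _≈_           = λ a b → a ≡ b mod q
  ; isEquivalence = record { refl = ≡mod-refl ; sym = ≡mod-sym ; trans = ≡mod-trans }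
  }

≤∧≡mod⇒≡ : {q a b : ℕ} → b ≤ a → a < q → + a ≡ + b mod q → a ≡ b
≤∧≡mod⇒≡ {q} {a} {b} b≤a a<q p = ℕₚ.≤-antisym (ℕₚ.m∸n≡0⇒m≤n (small-multiple (a ∸ b) q∣a∸b a∸b<q)) b≤a
  where
  q∣a∸b : (+ q) ℤ∣.∣ (+ (a ∸ b))
  q∣a∸b = subst ((+ q) ℤ∣.∣_) (trans (ℤₚ.m-n≡m⊖n a b) (ℤₚ.⊖-≥ b≤a)) (∣-difference p)
  a∸b<q : a ∸ b < q
  a∸b<q = ℕₚ.≤-<-trans (ℕₚ.m∸n≤m a b) a<q
  small-multiple : ∀ d → (+ q) ℤ∣.∣ (+ d) → d < q → d ≡ 0
  small-multiple zero    _  _   = refl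
  small-multiple (suc d) q∣d d<q = ⊥-elim (ℕₚ.<⇒≱ d<q (ℕ∣.∣⇒≤ (ℤ∣.∣⇒∣ᵤ q∣d)))

≡mod⇒≡ : {q a b : ℕ} → a < q → b < q → + a ≡ + b mod q → a ≡ b
≡mod⇒≡ {q} {a} {b} a<q b<q p with ℕₚ.≤-total b a
... | inj₁ b≤a = ≤∧≡mod⇒≡ b≤a a<q p
... | inj₂ a≤b = sym (≤∧≡mod⇒≡ a≤b b<q (≡mod-sym p))

-- R_n and H₁(Y_n, ℤ) = R_n / R_n'

module Abelianisation {m : ℕ} (n : ℕ) where

  InR⇒∣ : {w : Word m} → InR n w → (+ n) ℤ∣.∣ expSum w
  InR⇒∣ {w} = ℤ∣.∣ᵤ⇒∣ {+ n} {expSum w}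

  ∣⇒InR : {w : Word m} → (+ n) ℤ∣.∣ expSum w → InR n w
  ∣⇒InR {w} = ℤ∣.∣⇒∣ᵤ {+ n} {expSum w}

  InR-[] : InR {m} n []
  InR-[] = ∣⇒InR {[]} (ℤ∣.divides (+ 0) refl)

  InR-++ : {u v : Word m} → InR n u → InR n v → InR n (u ++ v)
  InR-++ {u} {v} p q =
    ∣⇒InR {u ++ v} (subst ((+ n) ℤ∣.∣_) (sym (expSum-++ u v)) (ℤ∣.∣m∣n⇒∣m+n (InR⇒∣ {u} p) (InR⇒∣ {v} q)))

  InR-inv : {u : Word m} → InR n u → InR n (inv u)
  InR-inv {u} p = ∣⇒InR {inv u} (subst ((+ n) ℤ∣.∣_) (sym (expSum-inv u)) (ℤ∣.∣m⇒∣-m (InR⇒∣ {u} p)))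

  InR-concat-replicate : (k : ℕ) {g : Word m} → InR n g → InR n (concat (replicate k g))
  InR-concat-replicate zero        q = InR-[]
  InR-concat-replicate (suc k) {g} q = InR-++ {g} q (InR-concat-replicate k q)

  InR-pow : {h : Word m} (z : ℤ) → InR n h → InR n (pow h z)
  InR-pow {h} (+ k)    p = InR-concat-replicate k {h} p
  InR-pow {h} -[1+ k ] p = InR-concat-replicate (suc k) {inv h} (InR-inv {h} p)

  InRComm-++ : {u v : Word m} → InRComm n u → InRComm n v → InRComm n (u ++ v)
  InRComm-++ rc-nil q = q
  InRComm-++ {v = v} (rc-step a b w pa pb pw) q =
    subst (InRComm n) (sym (++-assoc (comm a b) w v)) (rc-step a b (w ++ v) pa pb (InRComm-++ pw q))
  InRComm-++ {v = v} (rc-resp p r) q = rc-resp (≈F-congʳ v p) (InRComm-++ r q)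

  inv-comm : (a b : Word m) → inv (comm a b) ≡ comm b a
  inv-comm a b = begin
    inv (a ++ b ++ inv a ++ inv b)                    ≡⟨ inv-++ a _ ⟩
    inv (b ++ inv a ++ inv b) ++ inv a                ≡⟨ cong (_++ inv a) (inv-++ b _) ⟩
    (inv (inv a ++ inv b) ++ inv b) ++ inv a          ≡⟨ cong (λ z → (z ++ inv b) ++ inv a) (inv-++ (inv a) (inv b)) ⟩
    ((inv (inv b) ++ inv (inv a)) ++ inv b) ++ inv a
      ≡⟨ cong₂ (λ y z → ((y ++ z) ++ inv b) ++ inv a) (inv-involutive b) (inv-involutive a) ⟩
    ((b ++ a) ++ inv b) ++ inv a                      ≡⟨ ++-assoc (b ++ a) (inv b) (inv a) ⟩
    (b ++ a) ++ inv b ++ inv a                        ≡⟨ ++-assoc b a _ ⟩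
    comm b a                                          ∎
    where open ≡-Reasoning

  InRComm-inv : {u : Word m} → InRComm n u → InRComm n (inv u)
  InRComm-inv rc-nil = rc-nil
  InRComm-inv (rc-step a b w pa pb pw) =
    subst (InRComm n) (sym inv-step) (InRComm-++ (InRComm-inv pw) (rc-step b a [] pb pa rc-nil))
    where
    inv-step : inv (comm a b ++ w) ≡ inv w ++ comm b a ++ []
    inv-step = trans (inv-++ (comm a b) w) (cong (inv w ++_) (trans (inv-comm a b) (sym (++-identityʳ (comm b a)))))
  InRComm-inv (rc-resp p q) = rc-resp (inv-cong p) (InRComm-inv q)

  -- Wrapping _≡H[ n ]_ in a record makes it injective, so the words can be inferred.
  infix 4 _≈H_
  record _≈H_ (r r' : Word m) : Set where
    constructor ⟨_⟩
    field ≡H : r ≡H[ n ] r'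
  open _≈H_ public

  ≈F⇒≈H : {u v : Word m} → u ≈F v → u ≈H v
  ≈F⇒≈H {u} p = ⟨ rc-resp (F-trans (F-sym (inverseʳ u)) (≈F-congˡ u (inv-cong p))) rc-nil ⟩

  ≈H-refl : {r : Word m} → r ≈H r
  ≈H-refl = ≈F⇒≈H F-refl

  ≈H-reflexive : {r r' : Word m} → r ≡ r' → r ≈H r'
  ≈H-reflexive refl = ≈H-refl

  ≈H-sym : {r r' : Word m} → r ≈H r' → r' ≈H r
  ≈H-sym {r} {r'} ⟨ p ⟩ =
    ⟨ subst (InRComm n) (trans (inv-++ r (inv r')) (cong (_++ inv r) (inv-involutive r'))) (InRComm-inv p) ⟩

  ≈H-trans : {r r' r'' : Word m} → r ≈H r' → r' ≈H r'' → r ≈H r''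
  ≈H-trans {r} {r'} {r''} ⟨ p ⟩ ⟨ q ⟩ = ⟨ rc-resp cancel-middle (InRComm-++ p q) ⟩
    where
    cancel-middle : ((r ++ inv r') ++ (r' ++ inv r'')) ≈F (r ++ inv r'')
    cancel-middle = F-trans (≈F-reflexive (trans (++-assoc r (inv r') _) (cong (r ++_) (sym (++-assoc (inv r') r' (inv r''))))))
                      (≈F-congˡ r (≈F-congʳ (inv r'') (inverseˡ r')))

  ≈H-congʳ : {r r' : Word m} (t : Word m) → r ≈H r' → (r ++ t) ≈H (r' ++ t)
  ≈H-congʳ {r} {r'} t ⟨ p ⟩ = ⟨ rc-resp (F-sym cancel-t) p ⟩
    where
    cancel-t : ((r ++ t) ++ inv (r' ++ t)) ≈F (r ++ inv r')
    cancel-t = F-trans (≈F-reflexive (trans (cong ((r ++ t) ++_) (inv-++ r' t))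
                 (trans (++-assoc r t _) (cong (r ++_) (sym (++-assoc t (inv t) (inv r')))))))
               (≈F-congˡ r (≈F-congʳ (inv r') (inverseʳ t)))

  ≈H-comm : {a b : Word m} → InR n a → InR n b → (a ++ b) ≈H (b ++ a)
  ≈H-comm {a} {b} pa pb = ⟨ subst (InRComm n) comm≡ (rc-step a b [] pa pb rc-nil) ⟩
    where
    comm≡ : comm a b ++ [] ≡ (a ++ b) ++ inv (b ++ a)
    comm≡ = trans (++-identityʳ (comm a b)) (trans (sym (++-assoc a b _)) (cong ((a ++ b) ++_) (sym (inv-++ b a))))

  ≈H-cong : {a b c d : Word m} → InR n b → InR n c → InR n d →
            a ≈H b → c ≈H d → (a ++ c) ≈H (b ++ d)
  ≈H-cong {b = b} {c} {d} pb pc pd p q =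
    ≈H-trans (≈H-congʳ c p) (≈H-trans (≈H-comm {b} {c} pb pc) (≈H-trans (≈H-congʳ b q) (≈H-comm {d} {b} pd pb)))

  H₁ : CommutativeMonoid _ _
  H₁ = record
    { Carrier = Σ (Word m) (InR n)
    ; _≈_     = λ (r , _) (r' , _) → r ≈H r'
    ; _∙_     = λ (r , p) (r' , p') → r ++ r' , InR-++ {r} {r'} p p'
    ; ε       = [] , InR-[]
    ; isCommutativeMonoid = record
      { isMonoid = record
        { isSemigroup = record
          { isMagma = record
            { isEquivalence = record { refl = ≈H-refl ; sym = ≈H-sym ; trans = ≈H-trans }
            ; ∙-cong = λ {_} {(b , pb)} {(c , pc)} {(d , pd)} → ≈H-cong {b = b} {c} {d} pb pc pd
            }
          ; assoc = λ (a , _) (b , _) (c , _) → ≈H-reflexive (++-assoc a b c)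
          }
        ; identity = (λ _ → ≈H-refl) , (λ (r , _) → ≈H-reflexive (++-identityʳ r))
        }
      ; comm = λ (r , p) (r' , p') → ≈H-comm {r} {r'} p p'
      }
    }

module Sums {c ℓ} (M : CommutativeMonoid c ℓ) where
  open CommutativeMonoid M using (Carrier; _≈_; _∙_; ε; setoid; ∙-congˡ; identityʳ) renaming (trans to ≈-trans)
  open import Algebra.Properties.CommutativeMonoid.Sum M
  open import Relation.Binary.Reasoning.Setoid setoid

  sum-ε : {k : ℕ} (t : Fin k → Carrier) → (∀ i → t i ≈ ε) → sum t ≈ ε
  sum-ε {k} t t≈ε = ≈-trans (sum-cong-≋ t≈ε) (sum-replicate-zero k)

  sum-single : {k : ℕ} (t : Fin k → Carrier) (i₀ : Fin k) → (∀ i → i ≢ i₀ → t i ≈ ε) → sum t ≈ t i₀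
  sum-single {suc k} t i₀ t≈ε = begin
    sum t                           ≈⟨ sum-remove t ⟩
    t i₀ ∙ sum (t ∘ Fin.punchIn i₀) ≈⟨ ∙-congˡ (sum-ε _ (λ i → t≈ε _ (Finₚ.punchInᵢ≢i i₀ i))) ⟩
    t i₀ ∙ ε                        ≈⟨ identityʳ (t i₀) ⟩
    t i₀                            ∎

  module Edges (m n : ℕ) where

    ∑∑ : (Fin m → ℕ → Carrier) → Carrier
    ∑∑ φ = ∑[ j < m ] ∑[ i < n ] φ j (toℕ i)

    ∑∑-cong : {φ ψ : Fin m → ℕ → Carrier} → (∀ j i → i < n → φ j i ≈ ψ j i) → ∑∑ φ ≈ ∑∑ ψ
    ∑∑-cong φ≈ψ = sum-cong-≋ (λ j → sum-cong-≋ (λ i → φ≈ψ j (toℕ i) (Finₚ.toℕ<n i)))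

    ∑∑-distrib : (φ ψ : Fin m → ℕ → Carrier) → ∑∑ (λ j i → φ j i ∙ ψ j i) ≈ ∑∑ φ ∙ ∑∑ ψ
    ∑∑-distrib φ ψ =
      ≈-trans (sum-cong-≋ {m} (λ j → ∑-distrib-+ {n} (λ i → φ j (toℕ i)) (λ i → ψ j (toℕ i))))
        (∑-distrib-+ (λ j → ∑[ i < n ] φ j (toℕ i)) (λ j → ∑[ i < n ] ψ j (toℕ i)))

    ∑∑-ε : {φ : Fin m → ℕ → Carrier} → (∀ j i → i < n → φ j i ≈ ε) → ∑∑ φ ≈ ε
    ∑∑-ε φ≈ε = sum-ε _ (λ j → sum-ε _ (λ i → φ≈ε j (toℕ i) (Finₚ.toℕ<n i)))

    ∑∑-single : {φ : Fin m → ℕ → Carrier} (j₀ : Fin m) {k : ℕ} → k < n →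
                (∀ j i → i < n → ¬ (j ≡ j₀ × i ≡ k) → φ j i ≈ ε) → ∑∑ φ ≈ φ j₀ k
    ∑∑-single {φ} j₀ {k} k<n φ≈ε = begin
      ∑∑ φ                                  ≈⟨ sum-single _ j₀ (λ j j≢j₀ → ∑∑-ε-row j j≢j₀) ⟩
      ∑[ i < n ] φ j₀ (toℕ i)
        ≈⟨ sum-single _ (Fin.fromℕ< k<n) (λ i i≢k → φ≈ε j₀ _ (Finₚ.toℕ<n i) (λ (_ , i≡k) → i≢k (toℕ≡k⇒ i≡k))) ⟩
      φ j₀ (toℕ (Fin.fromℕ< k<n))           ≡⟨ cong (φ j₀) (Finₚ.toℕ-fromℕ< k<n) ⟩
      φ j₀ k                                ∎
      where
      ∑∑-ε-row : ∀ j → j ≢ j₀ → ∑[ i < n ] φ j (toℕ i) ≈ ε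
      ∑∑-ε-row j j≢j₀ = sum-ε _ (λ i → φ≈ε j _ (Finₚ.toℕ<n i) (λ (j≡j₀ , _) → j≢j₀ j≡j₀))
      toℕ≡k⇒ : {i : Fin n} → toℕ i ≡ k → i ≡ Fin.fromℕ< k<n
      toℕ≡k⇒ i≡k = Finₚ.toℕ-injective (trans i≡k (sym (Finₚ.toℕ-fromℕ< k<n)))

module SumHomomorphism {c₁ c₂ ℓ₁ ℓ₂} (M : CommutativeMonoid c₁ ℓ₁) (N : CommutativeMonoid c₂ ℓ₂)
  (f : CommutativeMonoid.Carrier M → CommutativeMonoid.Carrier N)
  (f-ε : CommutativeMonoid._≈_ N (f (CommutativeMonoid.ε M)) (CommutativeMonoid.ε N))
  (f-∙ : ∀ a b → CommutativeMonoid._≈_ N (f (CommutativeMonoid._∙_ M a b)) (CommutativeMonoid._∙_ N (f a) (f b)))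
  where
  private
    module M = CommutativeMonoid M
    module N = CommutativeMonoid N
    module ΣM = Algebra.Properties.CommutativeMonoid.Sum M
    module ΣN = Algebra.Properties.CommutativeMonoid.Sum N

  sum-homo : {k : ℕ} (t : Fin k → M.Carrier) → f (ΣM.sum t) N.≈ ΣN.sum (f ∘ t)
  sum-homo {zero}  t = f-ε
  sum-homo {suc k} t = N.trans (f-∙ _ _) (N.∙-congˡ (sum-homo (t ∘ suc)))

  ∑∑-homo : {m n : ℕ} (φ : Fin m → ℕ → M.Carrier) →
            f (Sums.Edges.∑∑ M m n φ) N.≈ Sums.Edges.∑∑ N m n (λ j i → f (φ j i))
  ∑∑-homo {m} {n} φ =
    N.trans (sum-homo {m} (λ j → ΣM.sum {n} (λ i → φ j (toℕ i)))) (ΣN.sum-cong-≋ {m} (λ j → sum-homo {n} (λ i → φ j (toℕ i))))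

module ℤΣ = Algebra.Properties.CommutativeMonoid.Sum ℤₚ.+-0-commutativeMonoid
open Sums ℤₚ.+-0-commutativeMonoid using () renaming (sum-single to ℤ-sum-single)

module Digits (ℓ' : ℕ) where

  ℓ : ℕ
  ℓ = suc ℓ'

  ⌊_⌋ : Zℓ → ℕ → ℤ
  ⌊ a ⌋ k = + partial ℓ a k

  ≈ℓ⇒≡mod : {a b : Zℓ} → a ≈[ ℓ ] b → ∀ k → ⌊ a ⌋ k ≡ ⌊ b ⌋ k mod ℓ ^ k
  ≈ℓ⇒≡mod {a} {b} a≈b k = ≡mod (ℤ∣.∣ᵤ⇒∣ {+ (ℓ ^ k)} {⌊ a ⌋ k - ⌊ b ⌋ k} (a≈b k))

  ≡mod⇒≈ℓ : {a b : Zℓ} → (∀ k → ⌊ a ⌋ k ≡ ⌊ b ⌋ k mod ℓ ^ k) → a ≈[ ℓ ] b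
  ≡mod⇒≈ℓ {a} {b} a≡b k = ℤ∣.∣⇒∣ᵤ {+ (ℓ ^ k)} {⌊ a ⌋ k - ⌊ b ⌋ k} (∣-difference (a≡b k))

  partial-0ℓ : (k : ℕ) → partial ℓ 0ℓ k ≡ 0
  partial-0ℓ zero    = refl
  partial-0ℓ (suc k) = trans (ℕₚ.+-identityʳ _) (partial-0ℓ k)

  partial-+ℓ : (a b : Zℓ) (k : ℕ) → partial ℓ (a +ℓ b) k ≡ partial ℓ a k ℕ.+ partial ℓ b k
  partial-+ℓ a b zero    = refl
  partial-+ℓ a b (suc k) =
    trans (cong (ℕ._+ (a k ℕ.+ b k) ℕ.* ℓ ^ k) (partial-+ℓ a b k)) (regroup (partial ℓ a k) (partial ℓ b k) (a k) (b k) (ℓ ^ k))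
    where
    regroup : ∀ A B x y P → A ℕ.+ B ℕ.+ (x ℕ.+ y) ℕ.* P ≡ A ℕ.+ x ℕ.* P ℕ.+ (B ℕ.+ y ℕ.* P)
    regroup = ℕ-solve-∀

  ⌊⌋-+ℓ : (a b : Zℓ) (k : ℕ) → ⌊ a +ℓ b ⌋ k ≡ ⌊ a ⌋ k + ⌊ b ⌋ k
  ⌊⌋-+ℓ a b k = trans (cong +_ (partial-+ℓ a b k)) (ℤₚ.pos-+ (partial ℓ a k) (partial ℓ b k))

  scale : ℕ → Zℓ → Zℓ
  scale q a i = q ℕ.* a i

  partial-scale : (q : ℕ) (a : Zℓ) (k : ℕ) → partial ℓ (scale q a) k ≡ q ℕ.* partial ℓ a k
  partial-scale q a zero    = sym (ℕₚ.*-zeroʳ q)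
  partial-scale q a (suc k) =
    trans (cong (ℕ._+ q ℕ.* a k ℕ.* ℓ ^ k) (partial-scale q a k)) (factor q (partial ℓ a k) (a k) (ℓ ^ k))
    where
    factor : ∀ q A x P → q ℕ.* A ℕ.+ q ℕ.* x ℕ.* P ≡ q ℕ.* (A ℕ.+ x ℕ.* P)
    factor = ℕ-solve-∀

  prefixSum : Zℓ → ℕ → ℕ
  prefixSum a zero    = 0
  prefixSum a (suc k) = prefixSum a k ℕ.+ a k

  -- Adding ℓ - 1 times the running sum of the digits makes every carry propagate: the
  -- first k digits of a + negateℓ a sum to ℓ^k · (a_0 + … + a_(k-1)) ≡ 0 mod ℓ^k.
  negateℓ : Zℓ → Zℓ
  negateℓ a i = ℓ' ℕ.* (prefixSum a i ℕ.+ a i)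

  partial-negateℓ : (a : Zℓ) (k : ℕ) → partial ℓ (a +ℓ negateℓ a) k ≡ ℓ ^ k ℕ.* prefixSum a k
  partial-negateℓ a zero    = refl
  partial-negateℓ a (suc k) =
    trans (cong (ℕ._+ (a k ℕ.+ ℓ' ℕ.* (prefixSum a k ℕ.+ a k)) ℕ.* ℓ ^ k) (partial-negateℓ a k))
      (carry ℓ' (ℓ ^ k) (prefixSum a k) (a k))
    where
    carry : ∀ l P s x → P ℕ.* s ℕ.+ (x ℕ.+ l ℕ.* (s ℕ.+ x)) ℕ.* P ≡ ((1 ℕ.+ l) ℕ.* P) ℕ.* (s ℕ.+ x)
    carry = ℕ-solve-∀

  ⌊⌋-negateℓ : (a : Zℓ) (k : ℕ) → ⌊ negateℓ a ⌋ k ≡ - ⌊ a ⌋ k mod ℓ ^ k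
  ⌊⌋-negateℓ a k = ≡mod (subst ((+ (ℓ ^ k)) ℤ∣.∣_) rearranged (ℤ∣.divides (+ prefixSum a k) multiple))
    where
    multiple : + (ℓ ^ k ℕ.* prefixSum a k) ≡ + prefixSum a k * + (ℓ ^ k)
    multiple = trans (cong +_ (ℕₚ.*-comm (ℓ ^ k) (prefixSum a k))) (ℤₚ.pos-* (prefixSum a k) (ℓ ^ k))
    swap : ∀ A N → A + N ≡ N - (- A)
    swap = solve-∀
    rearranged : + (ℓ ^ k ℕ.* prefixSum a k) ≡ ⌊ negateℓ a ⌋ k - - ⌊ a ⌋ k
    rearranged = trans (cong +_ (sym (partial-negateℓ a k))) (trans (⌊⌋-+ℓ a (negateℓ a) k) (swap (⌊ a ⌋ k) (⌊ negateℓ a ⌋ k)))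

  infixr 7 _·ℓ_
  _·ℓ_ : ℤ → Zℓ → Zℓ
  (+ q)    ·ℓ a = scale q a
  -[1+ q ] ·ℓ a = negateℓ (scale (suc q) a)

  ⌊⌋-·ℓ : (z : ℤ) (a : Zℓ) (k : ℕ) → ⌊ z ·ℓ a ⌋ k ≡ z * ⌊ a ⌋ k mod ℓ ^ k
  ⌊⌋-·ℓ (+ q)    a k = ≡mod-reflexive (trans (cong +_ (partial-scale q a k)) (ℤₚ.pos-* q (partial ℓ a k)))
  ⌊⌋-·ℓ -[1+ q ] a k =
    ≡mod-trans (⌊⌋-negateℓ (scale (suc q) a) k)
      (≡mod-reflexive (trans (cong -_ (trans (cong +_ (partial-scale (suc q) a k)) (ℤₚ.pos-* (suc q) _)))
                         (ℤₚ.neg-distribˡ-* (+ suc q) (⌊ a ⌋ k))))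

  negateℓ-inverseʳ : (a : Zℓ) → (a +ℓ negateℓ a) ≈[ ℓ ] 0ℓ
  negateℓ-inverseʳ a = ≡mod⇒≈ℓ (λ k →
    ≡mod-trans (≡mod-reflexive (⌊⌋-+ℓ a (negateℓ a) k))
      (≡mod-trans (≡mod-+-cong (≡mod-refl {a = ⌊ a ⌋ k}) (⌊⌋-negateℓ a k))
        (≡mod-reflexive (trans (ℤₚ.+-inverseʳ (⌊ a ⌋ k)) (cong +_ (sym (partial-0ℓ k)))))))

-- The n-fold cyclic cover: level k ∈ {0, …, n - 1} is the vertex R_n x^k, for any generator x

module Cover (n' : ℕ) where

  n : ℕ
  n = suc n'

  next : ℕ → ℕ
  next k with k ℕ.≟ n'
  ... | yes _ = 0
  ... | no  _ = suc k

  prev : ℕ → ℕ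
  prev zero    = n'
  prev (suc k) = k

  next≡suc : {k : ℕ} → suc k < n → next k ≡ suc k
  next≡suc {k} k+1<n with k ℕ.≟ n'
  ... | yes refl = ⊥-elim (ℕₚ.<-irrefl refl k+1<n)
  ... | no  _    = refl

  prev-next : (k : ℕ) → prev (next k) ≡ k
  prev-next k with k ℕ.≟ n'
  ... | yes k≡n' = sym k≡n'
  ... | no  _    = refl

  next-prev : {k : ℕ} → k < n → next (prev k) ≡ k
  next-prev {zero} _ with n' ℕ.≟ n'
  ... | yes _ = refl
  ... | no  n'≢n' = ⊥-elim (n'≢n' refl)
  next-prev {suc k} k<n = next≡suc k<n

  next-injective : {k k' : ℕ} → next k ≡ next k' → k ≡ k'
  next-injective {k} {k'} p = trans (sym (prev-next k)) (trans (cong prev p) (prev-next k'))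

  next-< : {k : ℕ} → k < n → next k < n
  next-< {k} k<n with k ℕ.≟ n'
  ... | yes _   = s≤s z≤n
  ... | no  k≢n' = s≤s (ℕₚ.≤∧≢⇒< (ℕₚ.≤-pred k<n) k≢n')

  prev-< : {k : ℕ} → k < n → prev k < n
  prev-< {zero}  _   = ℕₚ.≤-refl
  prev-< {suc k} k<n = ℕₚ.<-trans (ℕₚ.n<1+n k) k<n

  next-≡mod : (k : ℕ) → + next k ≡ + k + + 1 mod n
  next-≡mod k with k ℕ.≟ n'
  ... | yes refl = ≡mod (subst ((+ n) ℤ∣.∣_) (wrap (+ n')) (ℤ∣.∣m⇒∣-m (ℤ∣.∣-refl {+ n})))
    where
    wrap : ∀ a → - (+ 1 + a) ≡ + 0 - (a + + 1)
    wrap = solve-∀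
  ... | no  _    = ≡mod-reflexive (cong +_ (ℕₚ.+-comm 1 k))

  prev-≡mod : (k : ℕ) → + prev k ≡ + k + -[1+ 0 ] mod n
  prev-≡mod zero    = ≡mod (subst ((+ n) ℤ∣.∣_) (wrap (+ n')) (ℤ∣.∣-refl {+ n}))
    where
    wrap : ∀ a → + 1 + a ≡ a - (+ 0 + -[1+ 0 ])
    wrap = solve-∀
  prev-≡mod (suc k) = ≡mod-reflexive (unwrap (+ k))
    where
    unwrap : ∀ a → a ≡ (+ 1 + a) + -[1+ 0 ]
    unwrap = solve-∀

  module _ {m : ℕ} where
    open Abelianisation {m} n

    level : ℕ → Word m → ℕ
    level k []                = k
    level k ((_ , true)  ∷ w) = level (next k) w
    level k ((_ , false) ∷ w) = level (prev k) w

    level-< : {k : ℕ} (w : Word m) → k < n → level k w < n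
    level-< []                k<n = k<n
    level-< ((_ , true)  ∷ w) k<n = level-< w (next-< k<n)
    level-< ((_ , false) ∷ w) k<n = level-< w (prev-< k<n)

    level-≡mod : (k : ℕ) (w : Word m) → + level k w ≡ + k + expSum w mod n
    level-≡mod k [] = ≡mod-reflexive (sym (ℤₚ.+-identityʳ (+ k)))
    level-≡mod k ((_ , true) ∷ w) =
      ≡mod-trans (level-≡mod (next k) w)
        (≡mod-trans (≡mod-+-cong (next-≡mod k) (≡mod-refl {a = expSum w})) (≡mod-reflexive (ℤₚ.+-assoc (+ k) (+ 1) (expSum w))))
    level-≡mod k ((_ , false) ∷ w) =
      ≡mod-trans (level-≡mod (prev k) w)
        (≡mod-trans (≡mod-+-cong (prev-≡mod k) (≡mod-refl {a = expSum w})) (≡mod-reflexive (ℤₚ.+-assoc (+ k) -[1+ 0 ] (expSum w))))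

    level-InR : {k : ℕ} {w : Word m} → k < n → InR n w → level k w ≡ k
    level-InR {k} {w} k<n p = ≡mod⇒≡ (level-< w k<n) k<n
      (≡mod-trans (level-≡mod k w)
        (≡mod-trans (≡mod-+-cong (≡mod-refl {a = + k}) (∣⇒≡0-mod (InR⇒∣ {w} p))) (≡mod-reflexive (ℤₚ.+-identityʳ (+ k)))))

    -- chain k w is the 1-chain traced by the lift, starting at level k, of the path w in the
    -- bouquet of circles; the edge (j , i) leaves level i and is labelled x_j.
    Chain : Set
    Chain = Fin m → ℕ → ℤ

    edge : Fin m → ℕ → Chain
    edge j k j' i with j' Finₚ.≟ j | i ℕ.≟ k
    ... | yes _ | yes _ = + 1
    ... | _     | _     = + 0

    edge-on : (j : Fin m) (k : ℕ) → edge j k j k ≡ + 1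
    edge-on j k with j Finₚ.≟ j | k ℕ.≟ k
    ... | yes _ | yes _   = refl
    ... | no j≢j | _      = ⊥-elim (j≢j refl)
    ... | yes _ | no k≢k  = ⊥-elim (k≢k refl)

    edge-off : (j : Fin m) (k : ℕ) (j' : Fin m) (i : ℕ) → ¬ (j' ≡ j × i ≡ k) → edge j k j' i ≡ + 0
    edge-off j k j' i off with j' Finₚ.≟ j | i ℕ.≟ k
    ... | yes j'≡j | yes i≡k = ⊥-elim (off (j'≡j , i≡k))
    ... | yes _    | no  _   = refl
    ... | no  _    | _       = refl

    edge-next : (j : Fin m) (k : ℕ) (j' : Fin m) (i : ℕ) → edge j (next k) j' (next i) ≡ edge j k j' i
    edge-next j k j' i with j' Finₚ.≟ j | next i ℕ.≟ next k | i ℕ.≟ k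
    ... | no  _ | _      | _        = refl
    ... | yes _ | yes _  | yes _    = refl
    ... | yes _ | yes ni≡nk | no i≢k = ⊥-elim (i≢k (next-injective ni≡nk))
    ... | yes _ | no ni≢nk | yes refl = ⊥-elim (ni≢nk refl)
    ... | yes _ | no  _  | no  _    = refl

    chain : ℕ → Word m → Chain
    chain k []                j' i = + 0
    chain k ((j , true)  ∷ w) j' i = edge j k j' i + chain (next k) w j' i
    chain k ((j , false) ∷ w) j' i = - edge j (prev k) j' i + chain (prev k) w j' i

    chain-++ : (k : ℕ) (u v : Word m) (j : Fin m) (i : ℕ) →
               chain k (u ++ v) j i ≡ chain k u j i + chain (level k u) v j i
    chain-++ k []                v j i = sym (ℤₚ.+-identityˡ _)
    chain-++ k ((j' , true)  ∷ u) v j i =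
      trans (cong (_+_ (edge j' k j i)) (chain-++ (next k) u v j i)) (sym (ℤₚ.+-assoc (edge j' k j i) _ _))
    chain-++ k ((j' , false) ∷ u) v j i =
      trans (cong (_+_ (- edge j' (prev k) j i)) (chain-++ (prev k) u v j i)) (sym (ℤₚ.+-assoc (- edge j' (prev k) j i) _ _))

    chain-cancel : {k : ℕ} (x : Letter m) (v : Word m) → k < n → ∀ j i → chain k (x ∷ flipL x ∷ v) j i ≡ chain k v j i
    chain-cancel {k} (j' , true) v _ j i = begin
      edge j' k j i + (- edge j' (prev (next k)) j i + chain (prev (next k)) v j i)
        ≡⟨ cong (λ l → edge j' k j i + (- edge j' l j i + chain l v j i)) (prev-next k) ⟩
      edge j' k j i + (- edge j' k j i + chain k v j i)
        ≡⟨ cancel (edge j' k j i) _ ⟩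
      chain k v j i ∎
      where
      open ≡-Reasoning
      cancel : ∀ a b → a + (- a + b) ≡ b
      cancel = solve-∀
    chain-cancel {k} (j' , false) v k<n j i = begin
      - edge j' (prev k) j i + (edge j' (prev k) j i + chain (next (prev k)) v j i)
        ≡⟨ cong (λ l → - edge j' (prev k) j i + (edge j' (prev k) j i + chain l v j i)) (next-prev k<n) ⟩
      - edge j' (prev k) j i + (edge j' (prev k) j i + chain k v j i)
        ≡⟨ cancel (edge j' (prev k) j i) _ ⟩
      chain k v j i ∎
      where
      open ≡-Reasoning
      cancel : ∀ a b → - a + (a + b) ≡ b
      cancel = solve-∀

    chain-≈F : {k : ℕ} {u v : Word m} → k < n → u ≈F v → ∀ j i → chain k u j i ≡ chain k v j i
    chain-≈F k<n F-refl        j i = refl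
    chain-≈F k<n (F-sym p)     j i = sym (chain-≈F k<n p j i)
    chain-≈F k<n (F-trans p q) j i = trans (chain-≈F k<n p j i) (chain-≈F k<n q j i)
    chain-≈F {k} k<n (F-cancel u v x) j i = begin
      chain k (u ++ x ∷ flipL x ∷ v) j i                        ≡⟨ chain-++ k u _ j i ⟩
      chain k u j i + chain (level k u) (x ∷ flipL x ∷ v) j i   ≡⟨ cong (_+_ (chain k u j i)) (chain-cancel x v (level-< u k<n) j i) ⟩
      chain k u j i + chain (level k u) v j i                   ≡⟨ chain-++ k u v j i ⟨
      chain k (u ++ v) j i                                      ∎
      where open ≡-Reasoning

    chain-++ᴿ : {k : ℕ} (u v : Word m) → k < n → InR n u →
                ∀ j i → chain k (u ++ v) j i ≡ chain k u j i + chain k v j i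
    chain-++ᴿ {k} u v k<n p j i = trans (chain-++ k u v j i) (cong (λ l → chain k u j i + chain l v j i) (level-InR {w = u} k<n p))

    chain-inv : {k : ℕ} (u : Word m) → k < n → InR n u → ∀ j i → chain k (inv u) j i ≡ - chain k u j i
    chain-inv {k} u k<n p j i = ℤ-inverseʳ-unique (chain k u j i) _ (begin
      chain k u j i + chain k (inv u) j i  ≡⟨ chain-++ᴿ u (inv u) k<n p j i ⟨
      chain k (u ++ inv u) j i             ≡⟨ chain-≈F k<n (inverseʳ u) j i ⟩
      + 0                                  ∎)
      where open ≡-Reasoning

    chain-InRComm : {k : ℕ} {w : Word m} → k < n → InRComm n w → ∀ j i → chain k w j i ≡ + 0
    chain-InRComm k<n rc-nil j i = refl
    chain-InRComm {k} k<n (rc-step a b w pa pb pw) j i = begin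
      chain k (comm a b ++ w) j i
        ≡⟨ cong (λ z → chain k z j i) reassociate ⟩
      chain k (a ++ b ++ inv a ++ inv b ++ w) j i
        ≡⟨ additive ⟩
      chain k a j i + (chain k b j i + (chain k (inv a) j i + (chain k (inv b) j i + chain k w j i)))
        ≡⟨ cong₂ (λ a' b' → chain k a j i + (chain k b j i + (a' + (b' + chain k w j i))))
                 (chain-inv a k<n pa j i) (chain-inv b k<n pb j i) ⟩
      chain k a j i + (chain k b j i + (- chain k a j i + (- chain k b j i + chain k w j i)))
        ≡⟨ cancel (chain k a j i) (chain k b j i) (chain k w j i) ⟩
      chain k w j i
        ≡⟨ chain-InRComm k<n pw j i ⟩
      + 0 ∎
      where
      open ≡-Reasoning
      reassociate : comm a b ++ w ≡ a ++ b ++ inv a ++ inv b ++ w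
      reassociate = trans (++-assoc a _ w) (cong (a ++_) (trans (++-assoc b _ w) (cong (b ++_) (++-assoc (inv a) (inv b) w))))
      additive : chain k (a ++ b ++ inv a ++ inv b ++ w) j i ≡
                 chain k a j i + (chain k b j i + (chain k (inv a) j i + (chain k (inv b) j i + chain k w j i)))
      additive = trans (chain-++ᴿ a _ k<n pa j i) (cong (_+_ (chain k a j i))
                   (trans (chain-++ᴿ b _ k<n pb j i) (cong (_+_ (chain k b j i))
                     (trans (chain-++ᴿ (inv a) _ k<n (InR-inv {a} pa) j i) (cong (_+_ (chain k (inv a) j i))
                       (chain-++ᴿ (inv b) _ k<n (InR-inv {b} pb) j i))))))
      cancel : ∀ a b c → a + (b + (- a + (- b + c))) ≡ c
      cancel = solve-∀
    chain-InRComm k<n (rc-resp p q) j i = trans (sym (chain-≈F k<n p j i)) (chain-InRComm k<n q j i)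

    chain-≈H : {k : ℕ} {r r' : Word m} → k < n → InR n r → InR n r' → r ≈H r' → ∀ j i → chain k r j i ≡ chain k r' j i
    chain-≈H {k} {r} {r'} k<n p p' ⟨ h ⟩ j i = ℤ-x-y≡0⇒x≡y _ _ difference≡0
      where
      difference≡0 : chain k r j i + - chain k r' j i ≡ + 0
      difference≡0 = trans (cong (_+_ (chain k r j i)) (sym (chain-inv r' k<n p' j i)))
                       (trans (sym (chain-++ᴿ r (inv r') k<n p j i)) (chain-InRComm k<n h j i))

    chain-next : {k : ℕ} → k < n → (w : Word m) → ∀ j i → chain (next k) w j (next i) ≡ chain k w j i
    chain-next k<n [] j i = refl
    chain-next {k} k<n ((j' , true) ∷ w) j i =
      cong₂ _+_ (edge-next j' k j i) (chain-next (next-< k<n) w j i)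
    chain-next {k} k<n ((j' , false) ∷ w) j i = begin
      - edge j' (prev (next k)) j (next i) + chain (prev (next k)) w j (next i)
        ≡⟨ cong (λ l → - edge j' l j (next i) + chain l w j (next i)) (prev-next k) ⟩
      - edge j' k j (next i) + chain k w j (next i)
        ≡⟨ cong (λ l → - edge j' l j (next i) + chain l w j (next i)) (next-prev k<n) ⟨
      - edge j' (next (prev k)) j (next i) + chain (next (prev k)) w j (next i)
        ≡⟨ cong₂ (λ a b → - a + b) (edge-next j' (prev k) j i) (chain-next (prev-< k<n) w j i) ⟩
      - edge j' (prev k) j i + chain (prev k) w j i ∎
      where open ≡-Reasoning

    chain-conjugate : {k : ℕ} (x : Fin m) (r : Word m) → k < n → InR n r →
                      ∀ j i → chain k ((x , true) ∷ r ++ (x , false) ∷ []) j (next i) ≡ chain k r j i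
    chain-conjugate {k} x r k<n p j i = begin
      edge x k j (next i) + chain (next k) (r ++ (x , false) ∷ []) j (next i)
        ≡⟨ cong (_+_ (edge x k j (next i))) (chain-++ᴿ r _ (next-< k<n) p j (next i)) ⟩
      edge x k j (next i) + (chain (next k) r j (next i) + (- edge x (prev (next k)) j (next i) + + 0))
        ≡⟨ cong (λ l → edge x k j (next i) + (chain (next k) r j (next i) + (- edge x l j (next i) + + 0))) (prev-next k) ⟩
      edge x k j (next i) + (chain (next k) r j (next i) + (- edge x k j (next i) + + 0))
        ≡⟨ cancel (edge x k j (next i)) _ ⟩
      chain (next k) r j (next i)
        ≡⟨ chain-next k<n r j i ⟩
      chain k r j i ∎
      where
      open ≡-Reasoning
      cancel : ∀ a b → a + (b + (- a + + 0)) ≡ b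
      cancel = solve-∀

    xⁿ : Fin m → Word m
    xⁿ t = replicate n (t , true)

    edgesFrom : Fin m → ℕ → Chain
    edgesFrom t a j i with j Finₚ.≟ t | a ℕ.≤? i
    ... | yes _ | yes _ = + 1
    ... | _     | _     = + 0

    edgesFrom-suc : (t : Fin m) (a : ℕ) (j : Fin m) (i : ℕ) → edge t a j i + edgesFrom t (suc a) j i ≡ edgesFrom t a j i
    edgesFrom-suc t a j i with j Finₚ.≟ t | i ℕ.≟ a | suc a ℕ.≤? i | a ℕ.≤? i
    ... | no  _ | _        | _      | _      = refl
    ... | yes _ | yes refl | yes a<a | _     = ⊥-elim (ℕₚ.<-irrefl refl a<a)
    ... | yes _ | yes _    | no  _  | yes _  = refl
    ... | yes _ | yes refl | no  _  | no a≰a = ⊥-elim (a≰a ℕₚ.≤-refl)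
    ... | yes _ | no  _    | yes _  | yes _  = refl
    ... | yes _ | no  _    | yes a<i | no a≰i = ⊥-elim (a≰i (ℕₚ.<⇒≤ a<i))
    ... | yes _ | no i≢a   | no a≮i | yes a≤i = ⊥-elim (a≮i (ℕₚ.≤∧≢⇒< a≤i (λ a≡i → i≢a (sym a≡i))))
    ... | yes _ | no  _    | no  _  | no  _  = refl

    edgesFrom-beyond : (t : Fin m) {a : ℕ} (j : Fin m) {i : ℕ} → i < a → edgesFrom t a j i ≡ + 0
    edgesFrom-beyond t {a} j {i} i<a with j Finₚ.≟ t | a ℕ.≤? i
    ... | yes _ | yes a≤i = ⊥-elim (ℕₚ.<⇒≱ i<a a≤i)
    ... | yes _ | no  _   = refl
    ... | no  _ | _       = refl

    chain-replicate : (t : Fin m) (b : ℕ) {a : ℕ} → a ℕ.+ b ≡ n → ∀ j {i} → i < n →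
                      chain a (replicate b (t , true)) j i ≡ edgesFrom t a j i
    chain-replicate t zero {a} a+0≡n j {i} i<n =
      sym (edgesFrom-beyond t j (subst (i <_) (sym (trans (sym (ℕₚ.+-identityʳ a)) a+0≡n)) i<n))
    chain-replicate t (suc zero) {a} a+1≡n j {i} i<n =
      trans (cong (_+_ (edge t a j i)) (sym (edgesFrom-beyond t j (subst (i <_) (sym (trans (ℕₚ.+-comm 1 a) a+1≡n)) i<n))))
        (edgesFrom-suc t a j i)
    chain-replicate t (suc (suc b)) {a} a+b+2≡n j {i} i<n = begin
      edge t a j i + chain (next a) (replicate (suc b) (t , true)) j i
        ≡⟨ cong (λ l → edge t a j i + chain l (replicate (suc b) (t , true)) j i) (next≡suc suc-a<n) ⟩
      edge t a j i + chain (suc a) (replicate (suc b) (t , true)) j i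
        ≡⟨ cong (_+_ (edge t a j i)) (chain-replicate t (suc b) (trans (sym (ℕₚ.+-suc a (suc b))) a+b+2≡n) j i<n) ⟩
      edge t a j i + edgesFrom t (suc a) j i
        ≡⟨ edgesFrom-suc t a j i ⟩
      edgesFrom t a j i ∎
      where
      open ≡-Reasoning
      suc-a<n : suc a < n
      suc-a<n = subst (suc a <_) (trans (sym (trans (ℕₚ.+-suc a (suc b)) (cong suc (ℕₚ.+-suc a b)))) a+b+2≡n)
                  (s≤s (s≤s (ℕₚ.m≤m+n a b)))

    chain-xⁿ-on : (t : Fin m) {i : ℕ} → i < n → chain 0 (xⁿ t) t i ≡ + 1
    chain-xⁿ-on t {i} i<n with chain-replicate t n refl t i<n
    ... | chain≡ with t Finₚ.≟ t | 0 ℕ.≤? i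
    ...   | yes _ | yes _ = chain≡
    ...   | no t≢t | _    = ⊥-elim (t≢t refl)
    ...   | yes _ | no 0≰i = ⊥-elim (0≰i z≤n)

    chain-xⁿ-off : (t j : Fin m) → j ≢ t → ∀ {i} → i < n → chain 0 (xⁿ t) j i ≡ + 0
    chain-xⁿ-off t j j≢t {i} i<n with chain-replicate t n refl j i<n
    ... | chain≡ with j Finₚ.≟ t
    ...   | yes j≡t = ⊥-elim (j≢t j≡t)
    ...   | no  _   = chain≡

    InR-replicate-multiple : (t : Fin m) (q : ℕ) → InR n (replicate (q ℕ.* n) (t , true))
    InR-replicate-multiple t q = ∣⇒InR {replicate (q ℕ.* n) (t , true)}
      (subst ((+ n) ℤ∣.∣_) (sym (trans (expSum-replicate t (q ℕ.* n)) (ℤₚ.pos-* q n)))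
        (ℤ∣.∣n⇒∣m*n (+ q) (ℤ∣.∣-refl {+ n})))

    InR-xⁿ : (t : Fin m) → InR n (xⁿ t)
    InR-xⁿ t = subst (λ k → InR n (replicate k (t , true))) (ℕₚ.+-identityʳ n) (InR-replicate-multiple t 1)

    chain-replicate-multiple : (t : Fin m) (q : ℕ) → ∀ j {i} → i < n →
                               chain 0 (replicate (q ℕ.* n) (t , true)) j i ≡ + q * chain 0 (xⁿ t) j i
    chain-replicate-multiple t zero    j {i} i<n = sym (ℤₚ.*-zeroˡ (chain 0 (xⁿ t) j i))
    chain-replicate-multiple t (suc q) j {i} i<n = begin
      chain 0 (replicate (n ℕ.+ q ℕ.* n) (t , true)) j i
        ≡⟨ cong (λ w → chain 0 w j i) (replicate-+ n (q ℕ.* n) (t , true)) ⟩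
      chain 0 (xⁿ t ++ replicate (q ℕ.* n) (t , true)) j i
        ≡⟨ chain-++ᴿ (xⁿ t) (replicate (q ℕ.* n) (t , true)) (s≤s z≤n) (InR-xⁿ t) j i ⟩
      chain 0 (xⁿ t) j i + chain 0 (replicate (q ℕ.* n) (t , true)) j i
        ≡⟨ cong (_+_ (chain 0 (xⁿ t) j i)) (chain-replicate-multiple t q j i<n) ⟩
      chain 0 (xⁿ t) j i + + q * chain 0 (xⁿ t) j i                      ≡⟨ distribute (chain 0 (xⁿ t) j i) (+ q) ⟩
      + suc q * chain 0 (xⁿ t) j i                                       ∎
      where
      open ≡-Reasoning
      distribute : ∀ a q → a + q * a ≡ (+ 1 + q) * a
      distribute = solve-∀

    powL-positive : (t : Fin m) (q : ℕ) → powL t (+ n * + q) ≡ replicate (q ℕ.* n) (t , true)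
    powL-positive t q = cong (powL t) (trans (sym (ℤₚ.pos-* n q)) (cong +_ (ℕₚ.*-comm n q)))

    powL-negative : (t : Fin m) (q : ℕ) → powL t (+ n * -[1+ q ]) ≡ inv (replicate (suc q ℕ.* n) (t , true))
    powL-negative t q = begin
      powL t (+ n * -[1+ q ])                 ≡⟨ cong (powL t) (ℤₚ.neg-distribʳ-* (+ n) (+ suc q)) ⟨
      powL t (- (+ n * + suc q))
        ≡⟨ cong (λ z → powL t (- z)) (trans (sym (ℤₚ.pos-* n (suc q))) (cong +_ (ℕₚ.*-comm n (suc q)))) ⟩
      replicate (suc q ℕ.* n) (t , false)     ≡⟨ inv-replicate (suc q ℕ.* n) (t , true) ⟨
      inv (replicate (suc q ℕ.* n) (t , true)) ∎
      where open ≡-Reasoning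

    InR-powL : (t : Fin m) (z : ℤ) → InR n (powL t (+ n * z))
    InR-powL t (+ q)    = subst (InR n) (sym (powL-positive t q)) (InR-replicate-multiple t q)
    InR-powL t -[1+ q ] = subst (InR n) (sym (powL-negative t q)) (InR-inv {replicate (suc q ℕ.* n) (t , true)} (InR-replicate-multiple t (suc q)))

    chain-powL : (t : Fin m) (z : ℤ) → ∀ j {i} → i < n → chain 0 (powL t (+ n * z)) j i ≡ z * chain 0 (xⁿ t) j i
    chain-powL t (+ q) j {i} i<n =
      trans (cong (λ w → chain 0 w j i) (powL-positive t q)) (chain-replicate-multiple t q j i<n)
    chain-powL t -[1+ q ] j {i} i<n = begin
      chain 0 (powL t (+ n * -[1+ q ])) j i                          ≡⟨ cong (λ w → chain 0 w j i) (powL-negative t q) ⟩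
      chain 0 (inv (replicate (suc q ℕ.* n) (t , true))) j i
        ≡⟨ chain-inv (replicate (suc q ℕ.* n) (t , true)) (s≤s z≤n) (InR-replicate-multiple t (suc q)) j i ⟩
      - chain 0 (replicate (suc q ℕ.* n) (t , true)) j i             ≡⟨ cong -_ (chain-replicate-multiple t (suc q) j i<n) ⟩
      - (+ suc q * chain 0 (xⁿ t) j i)                               ≡⟨ ℤₚ.neg-distribˡ-* (+ suc q) _ ⟩
      -[1+ q ] * chain 0 (xⁿ t) j i                                  ∎
      where open ≡-Reasoning

    InR-concat : {K : ℕ} (B : Fin K → Word m) → (∀ t → InR n (B t)) → InR n (concat (tabulate B))
    InR-concat {zero}  B B∈R = InR-[]
    InR-concat {suc K} B B∈R = InR-++ {B zero} (B∈R zero) (InR-concat (B ∘ suc) (B∈R ∘ suc))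

    chain-concat : {K : ℕ} (B : Fin K → Word m) → (∀ t → InR n (B t)) →
                   ∀ j i → chain 0 (concat (tabulate B)) j i ≡ ℤΣ.sum (λ t → chain 0 (B t) j i)
    chain-concat {zero}  B B∈R j i = refl
    chain-concat {suc K} B B∈R j i =
      trans (chain-++ᴿ (B zero) _ (s≤s z≤n) (B∈R zero) j i)
        (cong (_+_ (chain 0 (B zero) j i)) (chain-concat (B ∘ suc) (B∈R ∘ suc) j i))

    genProd-tabulate : (c : Fin m → ℤ) → genProd n c ≡ concat (tabulate (λ t → powL t (+ n * c t)))
    genProd-tabulate c = cong concat (map-tabulate id (λ t → powL t (+ n * c t)))

    InR-genProd : (c : Fin m → ℤ) → InR n (genProd n c)
    InR-genProd c = subst (InR n) (sym (genProd-tabulate c)) (InR-concat _ (λ t → InR-powL t (c t)))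

    chain-genProd : (c : Fin m → ℤ) → ∀ j {i} → i < n → chain 0 (genProd n c) j i ≡ c j
    chain-genProd c j {i} i<n = begin
      chain 0 (genProd n c) j i                                   ≡⟨ cong (λ w → chain 0 w j i) (genProd-tabulate c) ⟩
      chain 0 (concat (tabulate (λ t → powL t (+ n * c t)))) j i  ≡⟨ chain-concat _ (λ t → InR-powL t (c t)) j i ⟩
      ℤΣ.sum (λ t → chain 0 (powL t (+ n * c t)) j i)             ≡⟨ ℤΣ.sum-cong-≗ (λ t → chain-powL t (c t) j i<n) ⟩
      ℤΣ.sum (λ t → c t * chain 0 (xⁿ t) j i)
        ≡⟨ ℤ-sum-single _ j (λ t t≢j → trans (cong (_*_ (c t)) (chain-xⁿ-off t j (λ j≡t → t≢j (sym j≡t)) i<n)) (ℤₚ.*-zeroʳ (c t))) ⟩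
      c j * chain 0 (xⁿ j) j i                                    ≡⟨ cong (_*_ (c j)) (chain-xⁿ-on j i<n) ⟩
      c j * + 1                                                   ≡⟨ ℤₚ.*-identityʳ (c j) ⟩
      c j                                                         ∎
      where open ≡-Reasoning

    -- Reidemeister–Schreier rewriting with respect to the transversal 1, x, …, x^(n-1)
    module Rewriting (x : Fin m) where

      x^ : ℕ → Word m
      x^ k = replicate k (x , true)

      schreier : Fin m → ℕ → Word m
      schreier j k = x^ k ++ (j , true) ∷ inv (x^ (next k))

      inv-schreier : (j : Fin m) (k : ℕ) → inv (schreier j k) ≡ x^ (next k) ++ (j , false) ∷ inv (x^ k)
      inv-schreier j k = begin
        inv (x^ k ++ (j , true) ∷ inv (x^ (next k)))              ≡⟨ inv-++ (x^ k) ((j , true) ∷ inv (x^ (next k))) ⟩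
        inv ((j , true) ∷ inv (x^ (next k))) ++ inv (x^ k)        ≡⟨ cong (_++ inv (x^ k)) (inv-++ ((j , true) ∷ []) (inv (x^ (next k)))) ⟩
        (inv (inv (x^ (next k))) ++ (j , false) ∷ []) ++ inv (x^ k)
          ≡⟨ cong (λ z → (z ++ (j , false) ∷ []) ++ inv (x^ k)) (inv-involutive (x^ (next k))) ⟩
        (x^ (next k) ++ (j , false) ∷ []) ++ inv (x^ k)           ≡⟨ ++-assoc (x^ (next k)) ((j , false) ∷ []) (inv (x^ k)) ⟩
        x^ (next k) ++ (j , false) ∷ inv (x^ k)                   ∎
        where open ≡-Reasoning

      InR-schreier : (j : Fin m) (k : ℕ) → InR n (schreier j k)
      InR-schreier j k = ∣⇒InR {schreier j k} (subst ((+ n) ℤ∣.∣_) (sym expSum≡) (ℤ∣.∣m⇒∣-m (∣-difference (next-≡mod k))))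
        where
        rearrange : ∀ a b → a + (+ 1 + - b) ≡ - (b - (a + + 1))
        rearrange = solve-∀
        expSum≡ : expSum (schreier j k) ≡ - (+ next k - (+ k + + 1))
        expSum≡ = begin
          expSum (schreier j k)                                  ≡⟨ expSum-++ (x^ k) ((j , true) ∷ inv (x^ (next k))) ⟩
          expSum (x^ k) + (+ 1 + expSum (inv (x^ (next k))))
            ≡⟨ cong₂ (λ a b → a + (+ 1 + b)) (expSum-replicate x k)
                     (trans (expSum-inv (x^ (next k))) (cong -_ (expSum-replicate x (next k)))) ⟩
          + k + (+ 1 + - (+ next k))                             ≡⟨ rearrange (+ k) (+ next k) ⟩
          - (+ next k - (+ k + + 1))                             ∎
          where open ≡-Reasoning

      schreierRewrite : ℕ → Word m → Word m
      schreierRewrite k []                = []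
      schreierRewrite k ((j , true)  ∷ w) = schreier j k ++ schreierRewrite (next k) w
      schreierRewrite k ((j , false) ∷ w) = inv (schreier j (prev k)) ++ schreierRewrite (prev k) w

      InR-schreierRewrite : (k : ℕ) (w : Word m) → InR n (schreierRewrite k w)
      InR-schreierRewrite k []                = InR-[]
      InR-schreierRewrite k ((j , true)  ∷ w) =
        InR-++ {schreier j k} (InR-schreier j k) (InR-schreierRewrite (next k) w)
      InR-schreierRewrite k ((j , false) ∷ w) =
        InR-++ {inv (schreier j (prev k))} (InR-inv {schreier j (prev k)} (InR-schreier j (prev k))) (InR-schreierRewrite (prev k) w)

      insert-inverse : (a : Word m) (y : Letter m) (h w : Word m) → (a ++ y ∷ w) ≈F ((a ++ y ∷ inv h) ++ h ++ w)
      insert-inverse a y h w =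
        F-trans (≈F-congˡ a (≈F-congˡ (y ∷ []) (F-sym (≈F-congʳ w (inverseˡ h)))))
          (≈F-reflexive (begin
            a ++ y ∷ (inv h ++ h) ++ w          ≡⟨ cong (λ z → a ++ y ∷ z) (++-assoc (inv h) h w) ⟩
            a ++ (y ∷ inv h) ++ h ++ w          ≡⟨ ++-assoc a (y ∷ inv h) (h ++ w) ⟨
            (a ++ y ∷ inv h) ++ h ++ w          ∎))
        where open ≡-Reasoning

      telescope : {k : ℕ} (w : Word m) → k < n → (x^ k ++ w) ≈F (schreierRewrite k w ++ x^ (level k w))
      telescope {k} [] _ = ≈F-reflexive (++-identityʳ (x^ k))
      telescope {k} ((j , true) ∷ w) k<n =
        F-trans (insert-inverse (x^ k) (j , true) (x^ (next k)) w)
          (F-trans (≈F-congˡ (schreier j k) (telescope w (next-< k<n)))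
            (≈F-reflexive (sym (++-assoc (schreier j k) _ _))))
      telescope {k} ((j , false) ∷ w) k<n =
        F-trans (≈F-reflexive (cong (λ l → x^ l ++ (j , false) ∷ w) (sym (next-prev k<n))))
          (F-trans (insert-inverse (x^ (next (prev k))) (j , false) (x^ (prev k)) w)
            (F-trans (≈F-reflexive (cong (_++ x^ (prev k) ++ w) (sym (inv-schreier j (prev k)))))
              (F-trans (≈F-congˡ (inv (schreier j (prev k))) (telescope w (prev-< k<n)))
                (≈F-reflexive (sym (++-assoc (inv (schreier j (prev k))) _ _))))))

      ≈F-schreierRewrite : {r : Word m} → InR n r → r ≈F schreierRewrite 0 r
      ≈F-schreierRewrite {r} p =
        F-trans (telescope r (s≤s z≤n))
          (≈F-reflexive (trans (cong (λ l → schreierRewrite 0 r ++ x^ l) (level-InR {w = r} (s≤s z≤n) p)) (++-identityʳ _)))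

      private
        module H = CommutativeMonoid H₁
        module H-Reasoning = Relation.Binary.Reasoning.Setoid H.setoid
      open Sums.Edges H₁ m n using (∑∑; ∑∑-cong; ∑∑-distrib; ∑∑-ε; ∑∑-single)

      generator : Fin m → ℕ → ℤ → H.Carrier
      generator j i z = pow (schreier j i) z , InR-pow z (InR-schreier j i)

      canonical : Chain → H.Carrier
      canonical c = ∑∑ (λ j i → generator j i (c j i))

      canonical-+ : (c d : Chain) → canonical (λ j i → c j i + d j i) H.≈ canonical c H.∙ canonical d
      canonical-+ c d = begin
        canonical (λ j i → c j i + d j i)
          ≈⟨ ∑∑-cong {φ = λ j i → generator j i (c j i + d j i)} {ψ = λ j i → generator j i (c j i) H.∙ generator j i (d j i)}
                     (λ j i _ → ≈F⇒≈H (pow-+ (schreier j i) (c j i) (d j i))) ⟩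
        ∑∑ (λ j i → generator j i (c j i) H.∙ generator j i (d j i))
          ≈⟨ ∑∑-distrib (λ j i → generator j i (c j i)) (λ j i → generator j i (d j i)) ⟩
        canonical c H.∙ canonical d                                  ∎
        where open H-Reasoning

      canonical-single : {c : Chain} (j₀ : Fin m) {k : ℕ} → k < n →
                         (∀ j i → i < n → ¬ (j ≡ j₀ × i ≡ k) → c j i ≡ + 0) → canonical c H.≈ generator j₀ k (c j₀ k)
      canonical-single {c} j₀ k<n c≡0 =
        ∑∑-single {φ = λ j i → generator j i (c j i)} j₀ k<n (λ j i i<n off → ≈H-reflexive (cong (pow (schreier j i)) (c≡0 j i i<n off)))

      canonical-edge : (j : Fin m) {k : ℕ} → k < n → canonical (edge j k) H.≈ (schreier j k , InR-schreier j k)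
      canonical-edge j {k} k<n = begin
        canonical (edge j k)                 ≈⟨ canonical-single {edge j k} j k<n (λ j' i _ → edge-off j k j' i) ⟩
        generator j k (edge j k j k)         ≡⟨ cong (generator j k) (edge-on j k) ⟩
        generator j k (+ 1)                  ≈⟨ ≈H-reflexive (++-identityʳ (schreier j k)) ⟩
        (schreier j k , InR-schreier j k)    ∎
        where open H-Reasoning

      canonical-neg-edge : (j : Fin m) {k : ℕ} → k < n →
                           canonical (λ j' i → - edge j k j' i) H.≈ (inv (schreier j k) , InR-inv {schreier j k} (InR-schreier j k))
      canonical-neg-edge j {k} k<n = begin
        canonical (λ j' i → - edge j k j' i)
          ≈⟨ canonical-single {λ j' i → - edge j k j' i} j k<n (λ j' i _ off → cong -_ (edge-off j k j' i off)) ⟩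
        generator j k (- edge j k j k)        ≡⟨ cong (λ z → generator j k (- z)) (edge-on j k) ⟩
        generator j k -[1+ 0 ]                ≈⟨ ≈H-reflexive (++-identityʳ (inv (schreier j k))) ⟩
        (inv (schreier j k) , InR-inv {schreier j k} (InR-schreier j k)) ∎
        where open H-Reasoning

      rewriting≈canonical : {k : ℕ} → k < n → (w : Word m) → schreierRewrite k w ≈H proj₁ (canonical (chain k w))
      rewriting≈canonical k<n [] = ≈H-sym (∑∑-ε {φ = λ j i → generator j i (+ 0)} (λ j i _ → ≈H-refl))
      rewriting≈canonical {k} k<n ((j , true) ∷ w) =
        ≈H-trans (≈H-cong (proj₂ (canonical (edge j k))) (InR-schreierRewrite (next k) w) (proj₂ (canonical (chain (next k) w)))
                    (≈H-sym (canonical-edge j k<n)) (rewriting≈canonical (next-< k<n) w))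
          (≈H-sym (canonical-+ (edge j k) (chain (next k) w)))
      rewriting≈canonical {k} k<n ((j , false) ∷ w) =
        ≈H-trans (≈H-cong (proj₂ (canonical (λ j' i → - edge j (prev k) j' i))) (InR-schreierRewrite (prev k) w)
                    (proj₂ (canonical (chain (prev k) w)))
                    (≈H-sym (canonical-neg-edge j (prev-< k<n))) (rewriting≈canonical (prev-< k<n) w))
          (≈H-sym (canonical-+ (λ j' i → - edge j (prev k) j' i) (chain (prev k) w)))

      ≈H-canonical : {r : Word m} → InR n r → r ≈H proj₁ (canonical (chain 0 r))
      ≈H-canonical {r} p = ≈H-trans (≈F⇒≈H (≈F-schreierRewrite p)) (rewriting≈canonical (s≤s z≤n) r)

      chain-injective : {r r' : Word m} → InR n r → InR n r' →
                        (∀ j i → i < n → chain 0 r j i ≡ chain 0 r' j i) → r ≈H r'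
      chain-injective {r} {r'} p p' same-chain =
        ≈H-trans (≈H-canonical p)
          (≈H-trans (∑∑-cong {φ = λ j i → generator j i (chain 0 r j i)} {ψ = λ j i → generator j i (chain 0 r' j i)}
                       (λ j i i<n → ≈H-reflexive (cong (pow (schreier j i)) (same-chain j i i<n))))
            (≈H-sym (≈H-canonical p')))

    constant-along-next : {c ℓ : _} (S : Setoid c ℓ) (v : ℕ → Setoid.Carrier S) →
                          (∀ i → i < n → Setoid._≈_ S (v (next i)) (v i)) → ∀ i → i < n → Setoid._≈_ S (v i) (v 0)
    constant-along-next S v v-next zero    _     = Setoid.refl S
    constant-along-next S v v-next (suc i) i+1<n =
      Setoid.trans S (Setoid.reflexive S (cong v (sym (next≡suc i+1<n))))
        (Setoid.trans S (v-next i i<n) (constant-along-next S v v-next i i<n))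
      where
      i<n : i < n
      i<n = ℕₚ.<-trans (ℕₚ.n<1+n i) i+1<n

    module Invariants (x : Fin m) where
      open Rewriting x using (chain-injective)

      conjugate : Word m → Word m
      conjugate r = (x , true) ∷ r ++ (x , false) ∷ []

      InR-conjugate : {r : Word m} → InR n r → InR n (conjugate r)
      InR-conjugate {r} p = ∣⇒InR {conjugate r} (subst ((+ n) ℤ∣.∣_) (sym expSum≡) (InR⇒∣ {r} p))
        where
        cancel : ∀ a → + 1 + (a + (-[1+ 0 ] + + 0)) ≡ a
        cancel = solve-∀
        expSum≡ : expSum (conjugate r) ≡ expSum r
        expSum≡ = trans (cong (λ z → + 1 + z) (expSum-++ r ((x , false) ∷ []))) (cancel (expSum r))

      invariant⇒genProd : {r : Word m} → InR n r → conjugate r ≈H r → Σ (Fin m → ℤ) (λ c → r ≈H genProd n c)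
      invariant⇒genProd {r} p invariant =
        c , chain-injective p (InR-genProd c) (λ j i i<n → trans (level-independent j i i<n) (sym (chain-genProd c j i<n)))
        where
        c : Fin m → ℤ
        c j = chain 0 r j 0
        shift-invariant : ∀ j i → i < n → chain 0 r j (next i) ≡ chain 0 r j i
        shift-invariant j i _ =
          trans (sym (chain-≈H (s≤s z≤n) (InR-conjugate {r} p) p invariant j (next i))) (chain-conjugate x r (s≤s z≤n) p j i)
        level-independent : ∀ j i → i < n → chain 0 r j i ≡ c j
        level-independent j = constant-along-next (≡-setoid ℤ) (chain 0 r j) (shift-invariant j)

      genProd⇒invariant : {r : Word m} → InR n r → Σ (Fin m → ℤ) (λ c → r ≈H genProd n c) → conjugate r ≈H r
      genProd⇒invariant {r} p (c , r≈genProd) = chain-injective (InR-conjugate {r} p) p same-chain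
        where
        chain≡c : ∀ j i → i < n → chain 0 r j i ≡ c j
        chain≡c j i i<n = trans (chain-≈H (s≤s z≤n) p (InR-genProd c) r≈genProd j i) (chain-genProd c j i<n)
        same-chain : ∀ j i → i < n → chain 0 (conjugate r) j i ≡ chain 0 r j i
        same-chain j i i<n = begin
          chain 0 (conjugate r) j i           ≡⟨ cong (chain 0 (conjugate r) j) (next-prev i<n) ⟨
          chain 0 (conjugate r) j (next (prev i)) ≡⟨ chain-conjugate x r (s≤s z≤n) p j (prev i) ⟩
          chain 0 r j (prev i)                ≡⟨ chain≡c j (prev i) (prev-< i<n) ⟩
          c j                                 ≡⟨ chain≡c j i i<n ⟨
          chain 0 r j i                       ∎
          where open ≡-Reasoning

    -- H₁(Y_n, ℤ_ℓ)
    module Tensor (x : Fin m) (ℓ' : ℕ) where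
      open Digits ℓ'
      open Rewriting x using (schreier; InR-schreier; generator; canonical; ≈H-canonical)
      open Invariants x using (conjugate; InR-conjugate)

      infix 4 _≈T_
      _≈T_ : TSum m → TSum m → Set
      t ≈T u = t ≈T[ n , ℓ ] u

      ≈T-reflexive : {t u : TSum m} → t ≡ u → t ≈T u
      ≈T-reflexive refl = T-refl

      ≈T-congˡ : (a : TSum m) {t u : TSum m} → t ≈T u → (a ++ t) ≈T (a ++ u)
      ≈T-congˡ a T-refl        = T-refl
      ≈T-congˡ a (T-sym p)     = T-sym (≈T-congˡ a p)
      ≈T-congˡ a (T-trans p q) = T-trans (≈T-congˡ a p) (≈T-congˡ a q)
      ≈T-congˡ a (T-step u v s) =
        T-trans (≈T-reflexive (sym (++-assoc a u _))) (T-trans (T-step (a ++ u) v s) (≈T-reflexive (++-assoc a u _)))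

      ≈T-congʳ : (b : TSum m) {t u : TSum m} → t ≈T u → (t ++ b) ≈T (u ++ b)
      ≈T-congʳ b T-refl        = T-refl
      ≈T-congʳ b (T-sym p)     = T-sym (≈T-congʳ b p)
      ≈T-congʳ b (T-trans p q) = T-trans (≈T-congʳ b p) (≈T-congʳ b q)
      ≈T-congʳ b (T-step u v {t} {t'} s) =
        T-trans (≈T-reflexive (trans (++-assoc u _ b) (cong (u ++_) (++-assoc t v b))))
          (T-trans (T-step u (v ++ b) s) (≈T-reflexive (sym (trans (++-assoc u _ b) (cong (u ++_) (++-assoc t' v b))))))

      TStep⇒≈T : {t t' : TSum m} → TStep n ℓ t t' → t ≈T t'
      TStep⇒≈T {t} {t'} s = T-trans (≈T-reflexive (sym (++-identityʳ t))) (T-trans (T-step [] [] s) (≈T-reflexive (++-identityʳ t')))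

      ∷-≈T-insert : (p : Word m × Zℓ) (u w : TSum m) → (p ∷ u ++ w) ≈T (u ++ p ∷ w)
      ∷-≈T-insert p []      w = T-refl
      ∷-≈T-insert p (q ∷ u) w = T-trans (≈T-congʳ (u ++ w) (TStep⇒≈T (t-swap p q))) (≈T-congˡ (q ∷ []) (∷-≈T-insert p u w))

      ≈T-comm : (t u : TSum m) → (t ++ u) ≈T (u ++ t)
      ≈T-comm []      u = ≈T-reflexive (sym (++-identityʳ u))
      ≈T-comm (p ∷ t) u = T-trans (≈T-congˡ (p ∷ []) (≈T-comm t u)) (∷-≈T-insert p u t)

      H₁ℓ : CommutativeMonoid _ _
      H₁ℓ = record
        { Carrier = TSum m
        ; _≈_     = _≈T_
        ; _∙_     = _++_
        ; ε       = []
        ; isCommutativeMonoid = record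
          { isMonoid = record
            { isSemigroup = record
              { isMagma = record
                { isEquivalence = record { refl = T-refl ; sym = T-sym ; trans = T-trans }
                ; ∙-cong = λ {_} {b} {c} p q → T-trans (≈T-congʳ c p) (≈T-congˡ b q)
                }
              ; assoc = λ a b c → ≈T-reflexive (++-assoc a b c)
              }
            ; identity = (λ _ → T-refl) , (λ t → ≈T-reflexive (++-identityʳ t))
            }
          ; comm = ≈T-comm
          }
        }

      private
        module T = CommutativeMonoid H₁ℓ
        module T-Reasoning = Relation.Binary.Reasoning.Setoid T.setoid
      open Sums.Edges H₁ℓ m n
        using () renaming (∑∑ to ∑∑ᵀ; ∑∑-cong to ∑∑ᵀ-cong; ∑∑-distrib to ∑∑ᵀ-distrib; ∑∑-ε to ∑∑ᵀ-ε)

      infix 6 _⊗_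
      _⊗_ : Word m → Zℓ → TSum m
      r ⊗ a = (r , a) ∷ []

      ⊗-split : {u w : Word m} (a : Zℓ) → InR n u → InR n w → ((u ++ w) ⊗ a) ≈T (u ⊗ a ++ w ⊗ a)
      ⊗-split {u} {w} a p q = T-sym (TStep⇒≈T (t-addH u w a p q))

      ⊗-negateℓ : {r : Word m} (a : Zℓ) → InR n r → (r ⊗ a ++ r ⊗ negateℓ a) ≈T []
      ⊗-negateℓ {r} a p =
        T-trans (TStep⇒≈T (t-addZ r a (negateℓ a) p))
          (T-trans (TStep⇒≈T (t-Zℓ r _ 0ℓ p (negateℓ-inverseʳ a))) (T-sym (TStep⇒≈T (t-zero r p))))

      []⊗ : (a : Zℓ) → ([] ⊗ a) ≈T []
      []⊗ a = begin
        [] ⊗ a                                ≈⟨ ≈T-congˡ ([] ⊗ a) (⊗-negateℓ a InR-[]) ⟨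
        [] ⊗ a ++ [] ⊗ a ++ [] ⊗ negateℓ a    ≈⟨ ≈T-congʳ ([] ⊗ negateℓ a) (⊗-split a InR-[] InR-[]) ⟨
        [] ⊗ a ++ [] ⊗ negateℓ a              ≈⟨ ⊗-negateℓ a InR-[] ⟩
        []                                    ∎
        where open T-Reasoning

      inv⊗ : {h : Word m} (b : Zℓ) → InR n h → (inv h ⊗ b) ≈T (h ⊗ negateℓ b)
      inv⊗ {h} b p = begin
        inv h ⊗ b                                 ≈⟨ ≈T-congˡ (inv h ⊗ b) (⊗-negateℓ b p) ⟨
        inv h ⊗ b ++ h ⊗ b ++ h ⊗ negateℓ b       ≈⟨ ≈T-congʳ (h ⊗ negateℓ b) (⊗-split b (InR-inv {h} p) p) ⟨
        (inv h ++ h) ⊗ b ++ h ⊗ negateℓ b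
          ≈⟨ ≈T-congʳ (h ⊗ negateℓ b) (TStep⇒≈T (t-H (inv h ++ h) [] b (InR-++ {inv h} (InR-inv {h} p) p) InR-[] (≡H (≈F⇒≈H (inverseˡ h))))) ⟩
        [] ⊗ b ++ h ⊗ negateℓ b                   ≈⟨ ≈T-congʳ (h ⊗ negateℓ b) ([]⊗ b) ⟩
        h ⊗ negateℓ b                             ∎
        where open T-Reasoning

      pow⊗ : {h : Word m} (z : ℤ) (a : Zℓ) → InR n h → (pow h z ⊗ a) ≈T (h ⊗ (z ·ℓ a))
      pow⊗ {h} (+ q)    a p = power q
        where
        power : (q : ℕ) → (pow h (+ q) ⊗ a) ≈T (h ⊗ scale q a)
        power zero    = T-trans ([]⊗ a) (TStep⇒≈T (t-zero h p))
        power (suc q) =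
          T-trans (⊗-split a p (InR-pow (+ q) p))
            (T-trans (≈T-congˡ (h ⊗ a) (power q)) (TStep⇒≈T (t-addZ h a (scale q a) p)))
      pow⊗ {h} -[1+ q ] a p = T-trans (pow⊗ {inv h} (+ suc q) a (InR-inv {h} p)) (inv⊗ (scale (suc q) a) p)

      canonicalT : (Fin m → ℕ → Zℓ) → TSum m
      canonicalT c = ∑∑ᵀ (λ j i → schreier j i ⊗ c j i)

      canonicalT-+ : (c d : Fin m → ℕ → Zℓ) → (canonicalT c ++ canonicalT d) ≈T canonicalT (λ j i → c j i +ℓ d j i)
      canonicalT-+ c d = T-sym (begin
        canonicalT (λ j i → c j i +ℓ d j i)
          ≈⟨ ∑∑ᵀ-cong {φ = λ j i → schreier j i ⊗ (c j i +ℓ d j i)} {ψ = λ j i → schreier j i ⊗ c j i ++ schreier j i ⊗ d j i}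
                      (λ j i _ → T-sym (TStep⇒≈T (t-addZ (schreier j i) (c j i) (d j i) (InR-schreier j i)))) ⟩
        ∑∑ᵀ (λ j i → schreier j i ⊗ c j i ++ schreier j i ⊗ d j i)
          ≈⟨ ∑∑ᵀ-distrib (λ j i → schreier j i ⊗ c j i) (λ j i → schreier j i ⊗ d j i) ⟩
        canonicalT c ++ canonicalT d ∎)
        where open T-Reasoning

      canonicalT-0ℓ : canonicalT (λ _ _ → 0ℓ) ≈T []
      canonicalT-0ℓ =
        ∑∑ᵀ-ε {φ = λ j i → schreier j i ⊗ 0ℓ} (λ j i _ → T-sym (TStep⇒≈T (t-zero (schreier j i) (InR-schreier j i))))

      ⊗≈canonicalT : {r : Word m} (a : Zℓ) → InR n r → (r ⊗ a) ≈T canonicalT (λ j i → chain 0 r j i ·ℓ a)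
      ⊗≈canonicalT {r} a p = begin
        r ⊗ a
          ≈⟨ TStep⇒≈T (t-H r (proj₁ (canonical (chain 0 r))) a p (proj₂ (canonical (chain 0 r))) (≡H (≈H-canonical p))) ⟩
        proj₁ (canonical (chain 0 r)) ⊗ a
          ≈⟨ ∑∑-homo {m} {n} (λ j i → generator j i (chain 0 r j i)) ⟩
        ∑∑ᵀ (λ j i → pow (schreier j i) (chain 0 r j i) ⊗ a)
          ≈⟨ ∑∑ᵀ-cong {φ = λ j i → pow (schreier j i) (chain 0 r j i) ⊗ a} {ψ = λ j i → schreier j i ⊗ (chain 0 r j i ·ℓ a)}
                      (λ j i _ → pow⊗ (chain 0 r j i) a (InR-schreier j i)) ⟩
        canonicalT (λ j i → chain 0 r j i ·ℓ a) ∎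
        where
        open T-Reasoning
        open SumHomomorphism H₁ H₁ℓ (λ u → proj₁ u ⊗ a) ([]⊗ a) (λ (u , p) (w , q) → ⊗-split {u} {w} a p q)

      coefficient : TSum m → Fin m → ℕ → Zℓ
      coefficient []            j i = 0ℓ
      coefficient ((r , a) ∷ t) j i = (chain 0 r j i ·ℓ a) +ℓ coefficient t j i

      ≈T-canonicalT : (t : TSum m) → All (λ p → InR n (proj₁ p)) t → t ≈T canonicalT (coefficient t)
      ≈T-canonicalT []            []       = T-sym canonicalT-0ℓ
      ≈T-canonicalT ((r , a) ∷ t) (p ∷ ps) = begin
        r ⊗ a ++ t                               ≈⟨ ≈T-congʳ t (⊗≈canonicalT a p) ⟩
        canonicalT c ++ t                        ≈⟨ ≈T-congˡ (canonicalT c) (≈T-canonicalT t ps) ⟩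
        canonicalT c ++ canonicalT (coefficient t) ≈⟨ canonicalT-+ c (coefficient t) ⟩
        canonicalT (coefficient ((r , a) ∷ t))   ∎
        where
        open T-Reasoning
        c : Fin m → ℕ → Zℓ
        c j i = chain 0 r j i ·ℓ a

      -- An integer version of ⌊ coefficient t j i ⌋ k: linear in t, hence easily checked against
      -- each relation of H₁(Y_n, ℤ_ℓ).
      pairing : TSum m → Fin m → ℕ → ℕ → ℤ
      pairing []            j i k = + 0
      pairing ((r , a) ∷ t) j i k = chain 0 r j i * ⌊ a ⌋ k + pairing t j i k

      pairing-++ : (t u : TSum m) → ∀ j i k → pairing (t ++ u) j i k ≡ pairing t j i k + pairing u j i k
      pairing-++ []            u j i k = sym (ℤₚ.+-identityˡ _)
      pairing-++ ((r , a) ∷ t) u j i k =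
        trans (cong (_+_ (chain 0 r j i * ⌊ a ⌋ k)) (pairing-++ t u j i k)) (sym (ℤₚ.+-assoc (chain 0 r j i * ⌊ a ⌋ k) _ _))

      pairing-TStep : {t t' : TSum m} → TStep n ℓ t t' → ∀ j i k → pairing t j i k ≡ pairing t' j i k mod ℓ ^ k
      pairing-TStep (t-swap (r , a) (r' , a')) j i k = ≡mod-reflexive (swap (chain 0 r j i * ⌊ a ⌋ k) (chain 0 r' j i * ⌊ a' ⌋ k))
        where
        swap : ∀ A B → A + (B + + 0) ≡ B + (A + + 0)
        swap = solve-∀
      pairing-TStep (t-addZ r a b p) j i k =
        ≡mod-reflexive (trans (distribute (chain 0 r j i) (⌊ a ⌋ k) (⌊ b ⌋ k))
                         (cong (λ z → chain 0 r j i * z + + 0) (sym (⌊⌋-+ℓ a b k))))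
        where
        distribute : ∀ c A B → c * A + (c * B + + 0) ≡ c * (A + B) + + 0
        distribute = solve-∀
      pairing-TStep (t-addH r r' a p p') j i k =
        ≡mod-reflexive (trans (distribute (chain 0 r j i) (chain 0 r' j i) (⌊ a ⌋ k))
                         (cong (λ z → z * ⌊ a ⌋ k + + 0) (sym (chain-++ᴿ r r' (s≤s z≤n) p j i))))
        where
        distribute : ∀ c c' A → c * A + (c' * A + + 0) ≡ (c + c') * A + + 0
        distribute = solve-∀
      pairing-TStep (t-H r r' a p p' h) j i k =
        ≡mod-reflexive (cong (λ z → z * ⌊ a ⌋ k + + 0) (chain-≈H {r = r} {r'} (s≤s z≤n) p p' ⟨ h ⟩ j i))
      pairing-TStep (t-Zℓ r a b p a≈b) j i k =
        ≡mod-+-cong (≡mod-*-congˡ (chain 0 r j i) (≈ℓ⇒≡mod a≈b k)) (≡mod-refl {a = + 0})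
      pairing-TStep (t-zero r p) j i k =
        ≡mod-reflexive (sym (trans (cong (λ z → chain 0 r j i * + z + + 0) (partial-0ℓ k)) (vanish (chain 0 r j i))))
        where
        vanish : ∀ c → c * + 0 + + 0 ≡ + 0
        vanish = solve-∀

      pairing-≈T : {t u : TSum m} → t ≈T u → ∀ j i k → pairing t j i k ≡ pairing u j i k mod ℓ ^ k
      pairing-≈T T-refl        j i k = ≡mod-refl
      pairing-≈T (T-sym p)     j i k = ≡mod-sym (pairing-≈T p j i k)
      pairing-≈T (T-trans p q) j i k = ≡mod-trans (pairing-≈T p j i k) (pairing-≈T q j i k)
      pairing-≈T (T-step u v {t} {t'} s) j i k =
        ≡mod-trans (≡mod-reflexive (expand t))
          (≡mod-trans (≡mod-+-cong (≡mod-refl {a = pairing u j i k})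
                                   (≡mod-+-cong (pairing-TStep s j i k) (≡mod-refl {a = pairing v j i k})))
            (≡mod-reflexive (sym (expand t'))))
        where
        expand : ∀ w → pairing (u ++ w ++ v) j i k ≡ pairing u j i k + (pairing w j i k + pairing v j i k)
        expand w = trans (pairing-++ u (w ++ v) j i k) (cong (_+_ (pairing u j i k)) (pairing-++ w v j i k))

      ⌊coefficient⌋ : (t : TSum m) → ∀ j i k → ⌊ coefficient t j i ⌋ k ≡ pairing t j i k mod ℓ ^ k
      ⌊coefficient⌋ []            j i k = ≡mod-reflexive (cong +_ (partial-0ℓ k))
      ⌊coefficient⌋ ((r , a) ∷ t) j i k =
        ≡mod-trans (≡mod-reflexive (⌊⌋-+ℓ (chain 0 r j i ·ℓ a) (coefficient t j i) k))
          (≡mod-+-cong (⌊⌋-·ℓ (chain 0 r j i) a k) (⌊coefficient⌋ t j i k))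

      pairing-injective : {t u : TSum m} → All (λ p → InR n (proj₁ p)) t → All (λ p → InR n (proj₁ p)) u →
                          (∀ j i k → i < n → pairing t j i k ≡ pairing u j i k mod ℓ ^ k) → t ≈T u
      pairing-injective {t} {u} t∈R u∈R same-pairing = begin
        t                            ≈⟨ ≈T-canonicalT t t∈R ⟩
        canonicalT (coefficient t)
          ≈⟨ ∑∑ᵀ-cong {φ = λ j i → schreier j i ⊗ coefficient t j i} {ψ = λ j i → schreier j i ⊗ coefficient u j i}
                      (λ j i i<n → TStep⇒≈T (t-Zℓ (schreier j i) _ _ (InR-schreier j i) (same-coefficient j i i<n))) ⟩
        canonicalT (coefficient u)   ≈⟨ ≈T-canonicalT u u∈R ⟨
        u                            ∎
        where
        open T-Reasoning
        same-coefficient : ∀ j i → i < n → coefficient t j i ≈[ ℓ ] coefficient u j i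
        same-coefficient j i i<n = ≡mod⇒≈ℓ (λ k →
          ≡mod-trans (⌊coefficient⌋ t j i k) (≡mod-trans (same-pairing j i k i<n) (≡mod-sym (⌊coefficient⌋ u j i k))))

      genSumℓ-tabulate : (c : Fin m → Zℓ) → genSumℓ n c ≡ tabulate (λ t → xⁿ t , c t)
      genSumℓ-tabulate c = map-tabulate id (λ t → xⁿ t , c t)

      All-tabulate : {K : ℕ} (B : Fin K → Word m × Zℓ) → (∀ t → InR n (proj₁ (B t))) → All (λ p → InR n (proj₁ p)) (tabulate B)
      All-tabulate {zero}  B B∈R = []
      All-tabulate {suc K} B B∈R = B∈R zero ∷ All-tabulate (B ∘ suc) (B∈R ∘ suc)

      All-genSumℓ : (c : Fin m → Zℓ) → All (λ p → InR n (proj₁ p)) (genSumℓ n c)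
      All-genSumℓ c = subst (All (λ p → InR n (proj₁ p))) (sym (genSumℓ-tabulate c)) (All-tabulate _ (λ t → InR-xⁿ t))

      pairing-tabulate : {K : ℕ} (B : Fin K → Word m × Zℓ) →
                         ∀ j i k → pairing (tabulate B) j i k ≡ ℤΣ.sum (λ t → chain 0 (proj₁ (B t)) j i * ⌊ proj₂ (B t) ⌋ k)
      pairing-tabulate {zero}  B j i k = refl
      pairing-tabulate {suc K} B j i k = cong (_+_ (chain 0 (proj₁ (B zero)) j i * ⌊ proj₂ (B zero) ⌋ k)) (pairing-tabulate (B ∘ suc) j i k)

      pairing-genSumℓ : (c : Fin m → Zℓ) → ∀ j {i} k → i < n → pairing (genSumℓ n c) j i k ≡ ⌊ c j ⌋ k
      pairing-genSumℓ c j {i} k i<n = begin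
        pairing (genSumℓ n c) j i k                                ≡⟨ cong (λ t → pairing t j i k) (genSumℓ-tabulate c) ⟩
        pairing (tabulate (λ t → xⁿ t , c t)) j i k                ≡⟨ pairing-tabulate (λ t → xⁿ t , c t) j i k ⟩
        ℤΣ.sum (λ t → chain 0 (xⁿ t) j i * ⌊ c t ⌋ k)
          ≡⟨ ℤ-sum-single _ j (λ t t≢j → cong (_* ⌊ c t ⌋ k) (chain-xⁿ-off t j (λ j≡t → t≢j (sym j≡t)) i<n)) ⟩
        chain 0 (xⁿ j) j i * ⌊ c j ⌋ k                             ≡⟨ cong (_* ⌊ c j ⌋ k) (chain-xⁿ-on j i<n) ⟩
        + 1 * ⌊ c j ⌋ k                                            ≡⟨ ℤₚ.*-identityˡ (⌊ c j ⌋ k) ⟩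
        ⌊ c j ⌋ k                                                  ∎
        where open ≡-Reasoning

      σ⊗ : TSum m → TSum m
      σ⊗ = map (λ (r , a) → conjugate r , a)

      All-σ⊗ : (t : TSum m) → All (λ p → InR n (proj₁ p)) t → All (λ p → InR n (proj₁ p)) (σ⊗ t)
      All-σ⊗ []            []       = []
      All-σ⊗ ((r , a) ∷ t) (p ∷ ps) = InR-conjugate {r} p ∷ All-σ⊗ t ps

      pairing-σ⊗ : (t : TSum m) → All (λ p → InR n (proj₁ p)) t → ∀ j i k → pairing (σ⊗ t) j (next i) k ≡ pairing t j i k
      pairing-σ⊗ []            []       j i k = refl
      pairing-σ⊗ ((r , a) ∷ t) (p ∷ ps) j i k =
        cong₂ (λ c rest → c * ⌊ a ⌋ k + rest) (chain-conjugate x r (s≤s z≤n) p j i) (pairing-σ⊗ t ps j i k)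

      invariant⇒genSumℓ : {t : TSum m} → All (λ p → InR n (proj₁ p)) t → σ⊗ t ≈T t →
                           Σ (Fin m → Zℓ) (λ c → t ≈T genSumℓ n c)
      invariant⇒genSumℓ {t} t∈R invariant =
        c , pairing-injective t∈R (All-genSumℓ c) (λ j i k i<n →
              ≡mod-trans (level-independent j k i i<n)
                (≡mod-trans (≡mod-sym (⌊coefficient⌋ t j 0 k)) (≡mod-reflexive (sym (pairing-genSumℓ c j k i<n)))))
        where
        c : Fin m → Zℓ
        c j = coefficient t j 0
        shift-invariant : ∀ j k i → i < n → pairing t j (next i) k ≡ pairing t j i k mod ℓ ^ k
        shift-invariant j k i _ =
          ≡mod-trans (≡mod-sym (pairing-≈T invariant j (next i) k)) (≡mod-reflexive (pairing-σ⊗ t t∈R j i k))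
        level-independent : ∀ j k i → i < n → pairing t j i k ≡ pairing t j 0 k mod ℓ ^ k
        level-independent j k = constant-along-next (≡mod-setoid (ℓ ^ k)) (λ i → pairing t j i k) (shift-invariant j k)

      genSumℓ⇒invariant : {t : TSum m} → All (λ p → InR n (proj₁ p)) t → Σ (Fin m → Zℓ) (λ c → t ≈T genSumℓ n c) →
                           σ⊗ t ≈T t
      genSumℓ⇒invariant {t} t∈R (c , t≈genSum) = pairing-injective (All-σ⊗ t t∈R) t∈R same-pairing
        where
        pairing≡c : ∀ j i k → i < n → pairing t j i k ≡ ⌊ c j ⌋ k mod ℓ ^ k
        pairing≡c j i k i<n = ≡mod-trans (pairing-≈T t≈genSum j i k) (≡mod-reflexive (pairing-genSumℓ c j k i<n))
        same-pairing : ∀ j i k → i < n → pairing (σ⊗ t) j i k ≡ pairing t j i k mod ℓ ^ k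
        same-pairing j i k i<n =
          ≡mod-trans (≡mod-reflexive (trans (cong (λ l → pairing (σ⊗ t) j l k) (sym (next-prev i<n))) (pairing-σ⊗ t t∈R j (prev i) k)))
            (≡mod-trans (pairing≡c j (prev i) k (prev-< i<n)) (≡mod-sym (pairing≡c j i k i<n)))

mainTheorem9 : (s n : ℕ) (h : 2 ≤ s) → 1 ≤ n → (ℓ : ℕ) → Prime ℓ →
    ((r : Word (s ∸ 1)) → InR n r →
      (conj₁ h r ≡H[ n ] r → Σ (Fin (s ∸ 1) → ℤ) (λ c → r ≡H[ n ] genProd n c))
      × (Σ (Fin (s ∸ 1) → ℤ) (λ c → r ≡H[ n ] genProd n c) → conj₁ h r ≡H[ n ] r))
    × ((t : TSum (s ∸ 1)) → All (λ p → InR n (proj₁ p)) t →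
      (σT h t ≈T[ n , ℓ ] t → Σ (Fin (s ∸ 1) → Zℓ) (λ c → t ≈T[ n , ℓ ] genSumℓ n c))
      × (Σ (Fin (s ∸ 1) → Zℓ) (λ c → t ≈T[ n , ℓ ] genSumℓ n c) → σT h t ≈T[ n , ℓ ] t))
mainTheorem9 (suc zero) _ (s≤s ()) _ _ _
-- Primality of ℓ is only used to exclude ℓ = 0.
mainTheorem9 (suc (suc k)) (suc n') _ _ zero ℓ-prime = ⊥-elim (¬prime[0] ℓ-prime)
mainTheorem9 (suc (suc k)) (suc n') _ _ (suc ℓ') _ =
  (λ r p → (λ invariant → map₂ ≡H (invariant⇒genProd p ⟨ invariant ⟩))
         , (λ (c , r≡genProd) → ≡H (genProd⇒invariant p (c , ⟨ r≡genProd ⟩))))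
  , (λ t t∈R → invariant⇒genSumℓ t∈R , genSumℓ⇒invariant t∈R)
  where
  open Abelianisation {suc k} (suc n') using (⟨_⟩; ≡H)
  open Cover n' using (module Invariants; module Tensor)
  open Invariants {suc k} zero using (invariant⇒genProd; genProd⇒invariant)
  open Tensor {suc k} zero ℓ' using (invariant⇒genSumℓ; genSumℓ⇒invariant)
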